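{- Let $a,b$ be complex numbers, let $f_3(z,a,b)=\sum_{n\ge0}c(n,3,a,b)z^n$ be the unique formal power series with $f_3=1+azf_3+bz^3f_3^2$, and $d_1^{(3)}(N,a,b)=\det\big(c(i+j+1,3,a,b)\big)_{i,j=0}^{N-1}$. Then $$d_1^{(3)}(3n,a,b)=(-1)^nb^{3n^2}\ (n\ge0),\qquad d_1^{(3)}(3n+1,a,b)=(-1)^n(n+1)ab^{3n^2+2n}\ (n\ge0),$$ $$d_1^{(3)}(3n-1,a,b)=(-1)^{n-1}nab^{3n^2-2n}\ (n\ge1).$$
   Context: The determinant of a $0\times0$ matrix is $1$. -}

module Defs where

open import Algebra.Bundles using (CommutativeRing)
open import Data.Nat using (ℕ; zero; suc)
import Data.Nat as N
open import Data.Fin using (Fin; zero; suc; toℕ; punchIn)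
import Data.Fin as Fin

module _ {c ℓ} (R : CommutativeRing c ℓ) where
  open CommutativeRing R using (Carrier; _≈_; _+_; _*_; -_; 0#; 1#)

  pow : Carrier → ℕ → Carrier
  pow x zero    = 1#
  pow x (suc n) = x * pow x n

  Series : Set c
  Series = ℕ → Carrier

  oneS : Series
  oneS zero    = 1#
  oneS (suc n) = 0#

  zS : Series → Series
  zS f zero    = 0#
  zS f (suc n) = f n

  scaleS : Carrier → Series → Series
  scaleS a f n = a * f n

  addS : Series → Series → Series
  addS f g n = f n + g n

  sumTo : ℕ → (ℕ → Carrier) → Carrier
  sumTo zero    h = 0#
  sumTo (suc n) h = sumTo n h + h n

  mulS : Series → Series → Series
  mulS f g n = sumTo (suc n) (λ k → f k * g (n N.∸ k))

  IsF3 : Carrier → Carrier → Series → Set ℓ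
  IsF3 a b f = ∀ n → f n ≈ addS oneS (addS (scaleS a (zS f)) (scaleS b (zS (zS (zS (mulS f f)))))) n

  sumFin : ∀ {n} → (Fin n → Carrier) → Carrier
  sumFin {zero}  h = 0#
  sumFin {suc n} h = h zero + sumFin (λ j → h (suc j))

  det : ∀ n → (Fin n → Fin n → Carrier) → Carrier
  det zero    M = 1#
  det (suc n) M =
    sumFin (λ j → pow (- 1#) (toℕ j) * (M Fin.zero j * det n (λ i k → M (Fin.suc i) (punchIn j k))))

  hankel1 : Series → ℕ → Carrier
  hankel1 f N = det N (λ i j → f (toℕ i N.+ toℕ j N.+ 1))

  natR : ℕ → Carrier
  natR zero    = 0#
  natR (suc n) = 1# + natR n

module Submission where

-- Deform the Hankel matrix to A_t = (f(i+j+1) + t f(i) f(j)), so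
-- that the theorem concerns A_0.  Let w = 1/f = 1 - a z - b z³ f and write
-- T(h) for the lower triangular Toeplitz matrix of a series h.  Right
-- multiplication by the upper unitriangular Tᵀ(w) is a sequence of column
-- operations, and applying it twice gives A_t Tᵀ(w) = T(f) X_t and
-- X_t Tᵀ(w) = T(f) M_t.  A third column operation E_t turns M_t into a
-- block lower triangular matrix with a 3 × 3 corner of determinant -b³ and
-- lower-right block b² A_{t+a}.  Since the factors T(f) on the left are lower
-- unitriangular, we track det_N(L A_t) for every lower unitriangular L and
-- obtain the recursion det_{m+3}(L A_t) = -b³ (b²)^m det_m(L′ A_{t+a}),
-- with initial values 1, a+t, (a+t) b computed directly (minors of size ≤ 3
-- are unchanged by L).  Its solution gives the three closed forms.

open import Defs
open import Algebra.Bundles using (CommutativeRing)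
open import Data.Nat as N using (ℕ; zero; suc; z≤n; s≤s; z<s)
import Data.Nat.Properties as NP
open import Data.Nat.Tactic.RingSolver using (solve-∀)
open import Data.Integer as ℤ using (ℤ; +_; -[1+_])
import Data.Integer.Properties as ℤP
import Data.Sign as Sign
open import Data.Fin as F using (Fin; toℕ)
import Data.Fin.Properties as FP
open import Data.Product using (_×_; _,_; proj₂)
open import Data.Maybe using (Maybe; just; nothing)
open import Data.Sum using (inj₁; inj₂)
open import Data.Empty using (⊥-elim)
open import Relation.Nullary using (Dec; yes; no)
open import Relation.Binary.Definitions using (tri<; tri≈; tri>)
open import Relation.Binary.PropositionalEquality as P using (_≡_; _≢_)
import Algebra.Properties.Ring as RingProperties
import Algebra.Properties.Group as GroupProperties
import Algebra.Properties.Semiring.Mult.TCOptimised as Multiples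
import Algebra.Solver.Ring
import Algebra.Solver.Ring.AlmostCommutativeRing as ACR

module Basics {c ℓ} (R : CommutativeRing c ℓ) where
  open CommutativeRing R public hiding (zero)
  open import Relation.Binary.Reasoning.Setoid setoid public
  open RingProperties ring public
    using (-‿involutive; -‿distribˡ-*; -‿distribʳ-*; -‿+-comm; -0#≈0#; -1*x≈-x)
  open GroupProperties +-group public using (inverseʳ-unique)
  open Multiples semiring using (1+×; ×-homo-+; ×1-homo-*) renaming (_×_ to _times_)

  -- The image of an integer in R.  Naturals use the type-checking
  -- optimised multiples, so that 0 and 1 are sent to 0# and 1# on the nose.
  ⟦_⟧ℤ : ℤ → Carrier
  ⟦ + n ⟧ℤ      = n times 1#
  ⟦ -[1+ n ] ⟧ℤ = - (suc n times 1#)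

  ⊖-hom : ∀ m n → ⟦ m ℤ.⊖ n ⟧ℤ ≈ m times 1# - n times 1#
  ⊖-hom m       zero    = sym (trans (+-congˡ -0#≈0#) (+-identityʳ _))
  ⊖-hom zero    (suc n) = sym (+-identityˡ _)
  ⊖-hom (suc m) (suc n) = begin
    ⟦ suc m ℤ.⊖ suc n ⟧ℤ            ≡⟨ P.cong ⟦_⟧ℤ (ℤP.[1+m]⊖[1+n]≡m⊖n m n) ⟩
    ⟦ m ℤ.⊖ n ⟧ℤ                    ≈⟨ ⊖-hom m n ⟩
    m times 1# - n times 1#                 ≈⟨ shift (m times 1#) (n times 1#) ⟩
    (1# + m times 1#) - (1# + n times 1#)   ≈⟨ sym (+-cong (1+× m 1#) (-‿cong (1+× n 1#))) ⟩
    suc m times 1# - suc n times 1#         ∎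
    where
    shift : ∀ x y → x - y ≈ (1# + x) - (1# + y)
    shift x y = begin
      x - y                   ≈⟨ sym (+-identityˡ _) ⟩
      0# + (x - y)            ≈⟨ +-congʳ (sym (-‿inverseʳ 1#)) ⟩
      (1# - 1#) + (x - y)     ≈⟨ +-assoc _ _ _ ⟩
      1# + (- 1# + (x - y))   ≈⟨ +-congˡ (trans (sym (+-assoc _ _ _)) (trans (+-congʳ (+-comm _ _)) (+-assoc _ _ _))) ⟩
      1# + (x + (- 1# - y))   ≈⟨ sym (+-assoc _ _ _) ⟩
      (1# + x) + (- 1# - y)   ≈⟨ +-congˡ (-‿+-comm 1# y) ⟩
      (1# + x) - (1# + y)     ∎

  neg-hom : ∀ i → ⟦ ℤ.- i ⟧ℤ ≈ - ⟦ i ⟧ℤ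
  neg-hom -[1+ n ]    = sym (-‿involutive _)
  neg-hom (+ zero)    = sym -0#≈0#
  neg-hom (+ suc n)   = refl

  +-hom : ∀ i j → ⟦ i ℤ.+ j ⟧ℤ ≈ ⟦ i ⟧ℤ + ⟦ j ⟧ℤ
  +-hom -[1+ m ] -[1+ n ] = begin
    - (suc (suc (m N.+ n)) times 1#)          ≈⟨ -‿cong (1+× (suc (m N.+ n)) 1#) ⟩
    - (1# + suc (m N.+ n) times 1#)           ≈⟨ -‿cong (+-congˡ (×-homo-+ 1# (suc m) n)) ⟩
    - (1# + (suc m times 1# + n times 1#))        ≈⟨ -‿cong (trans (sym (+-assoc _ _ _)) (trans (+-congʳ (+-comm _ _)) (+-assoc _ _ _))) ⟩
    - (suc m times 1# + (1# + n times 1#))        ≈⟨ -‿cong (+-congˡ (sym (1+× n 1#))) ⟩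
    - (suc m times 1# + suc n times 1#)           ≈⟨ sym (-‿+-comm _ _) ⟩
    - (suc m times 1#) - (suc n times 1#)         ∎
  +-hom -[1+ m ] (+ n)    = trans (⊖-hom n (suc m)) (+-comm _ _)
  +-hom (+ m)    -[1+ n ] = ⊖-hom m (suc n)
  +-hom (+ m)    (+ n)    = ×-homo-+ 1# m n

  -- the sign-magnitude form in which ℤ computes products
  ◃-neg : ∀ k → ⟦ Sign.- ℤ.◃ k ⟧ℤ ≈ - (k times 1#)
  ◃-neg k = trans (reflexive (P.cong ⟦_⟧ℤ (ℤP.-◃n≡-n k))) (neg-hom (+ k))

  ◃-pos : ∀ k → ⟦ Sign.+ ℤ.◃ k ⟧ℤ ≈ k times 1#
  ◃-pos k = reflexive (P.cong ⟦_⟧ℤ (ℤP.+◃n≡+n k))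

  *-hom : ∀ i j → ⟦ i ℤ.* j ⟧ℤ ≈ ⟦ i ⟧ℤ * ⟦ j ⟧ℤ
  *-hom -[1+ m ] -[1+ n ] = begin
    ⟦ Sign.+ ℤ.◃ (suc m N.* suc n) ⟧ℤ      ≈⟨ ◃-pos (suc m N.* suc n) ⟩
    (suc m N.* suc n) times 1#                ≈⟨ ×1-homo-* (suc m) (suc n) ⟩
    suc m times 1# * suc n times 1#               ≈⟨ sym (trans (sym (-‿distribˡ-* _ _)) (trans (-‿cong (sym (-‿distribʳ-* _ _))) (-‿involutive _))) ⟩
    - (suc m times 1#) * - (suc n times 1#)       ∎
  *-hom -[1+ m ] (+ n)    = trans (◃-neg (suc m N.* n)) (trans (-‿cong (×1-homo-* (suc m) n)) (-‿distribˡ-* _ _))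
  *-hom (+ m)    -[1+ n ] = trans (◃-neg (m N.* suc n)) (trans (-‿cong (×1-homo-* m (suc n))) (-‿distribʳ-* _ _))
  *-hom (+ m)    (+ n)    = trans (◃-pos (m N.* n)) (×1-homo-* m n)

  ℤ-morphism : ℤ.+-*-rawRing ACR.-Raw-AlmostCommutative⟶ ACR.fromCommutativeRing R
  ℤ-morphism = record
    { ⟦_⟧ = ⟦_⟧ℤ ; +-homo = +-hom ; *-homo = *-hom ; -‿homo = neg-hom
    ; 0-homo = refl ; 1-homo = refl }

  ℤ-equal? : ∀ i j → Maybe (⟦ i ⟧ℤ ≈ ⟦ j ⟧ℤ)
  ℤ-equal? i j with i ℤP.≟ j
  ... | yes P.refl = just refl
  ... | no _       = nothing

  module Solver = Algebra.Solver.Ring ℤ.+-*-rawRing (ACR.fromCommutativeRing R) ℤ-morphism ℤ-equal?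

  sum-cong : ∀ n {h g : ℕ → Carrier} → (∀ k → k N.< n → h k ≈ g k) → sumTo R n h ≈ sumTo R n g
  sum-cong zero    eq = refl
  sum-cong (suc n) eq = +-cong (sum-cong n (λ k k<n → eq k (NP.m<n⇒m<1+n k<n))) (eq n NP.≤-refl)

  sum-cong′ : ∀ n {h g : ℕ → Carrier} → (∀ k → h k ≈ g k) → sumTo R n h ≈ sumTo R n g
  sum-cong′ n eq = sum-cong n (λ k _ → eq k)

  sum-zero : ∀ n {h : ℕ → Carrier} → (∀ k → k N.< n → h k ≈ 0#) → sumTo R n h ≈ 0#
  sum-zero n eq = trans (sum-cong n eq) (zeros n)
    where
    zeros : ∀ n → sumTo R n (λ _ → 0#) ≈ 0#
    zeros zero    = refl
    zeros (suc n) = trans (+-identityʳ _) (zeros n)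

  sum-+ : ∀ n (h g : ℕ → Carrier) → sumTo R n (λ k → h k + g k) ≈ sumTo R n h + sumTo R n g
  sum-+ zero    h g = sym (+-identityˡ _)
  sum-+ (suc n) h g = trans (+-congʳ (sum-+ n h g)) (interchange _ _ _ _)
    where
    open Solver
    interchange : ∀ a b c d → (a + b) + (c + d) ≈ (a + c) + (b + d)
    interchange = solve 4 (λ a b c d → ((a :+ b) :+ (c :+ d)) := ((a :+ c) :+ (b :+ d))) refl

  sum-*ˡ : ∀ n x (h : ℕ → Carrier) → sumTo R n (λ k → x * h k) ≈ x * sumTo R n h
  sum-*ˡ zero    x h = sym (zeroʳ _)
  sum-*ˡ (suc n) x h = trans (+-congʳ (sum-*ˡ n x h)) (sym (distribˡ _ _ _))

  sum-*ʳ : ∀ n x (h : ℕ → Carrier) → sumTo R n (λ k → h k * x) ≈ sumTo R n h * x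
  sum-*ʳ n x h = trans (sum-cong′ n (λ k → *-comm _ _)) (trans (sum-*ˡ n x h) (*-comm _ _))

  sum-neg : ∀ n (h : ℕ → Carrier) → sumTo R n (λ k → - h k) ≈ - sumTo R n h
  sum-neg zero    h = sym -0#≈0#
  sum-neg (suc n) h = trans (+-congʳ (sum-neg n h)) (-‿+-comm _ _)

  sum-front : ∀ n (h : ℕ → Carrier) → sumTo R (suc n) h ≈ h 0 + sumTo R n (λ k → h (suc k))
  sum-front zero    h = trans (+-identityˡ _) (sym (+-identityʳ _))
  sum-front (suc n) h = trans (+-congʳ (sum-front n h)) (+-assoc _ _ _)

  sum-split : ∀ m n (h : ℕ → Carrier) → sumTo R (m N.+ n) h ≈ sumTo R m h + sumTo R n (λ k → h (m N.+ k))
  sum-split m zero    h = P.subst (λ z → sumTo R z h ≈ sumTo R m h + 0#) (P.sym (NP.+-identityʳ m)) (sym (+-identityʳ _))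
  sum-split m (suc n) h = begin
    sumTo R (m N.+ suc n) h                                    ≡⟨ P.cong (λ z → sumTo R z h) (NP.+-suc m n) ⟩
    sumTo R (m N.+ n) h + h (m N.+ n)                          ≈⟨ +-congʳ (sum-split m n h) ⟩
    (sumTo R m h + sumTo R n (λ k → h (m N.+ k))) + h (m N.+ n) ≈⟨ +-assoc _ _ _ ⟩
    sumTo R m h + sumTo R (suc n) (λ k → h (m N.+ k))          ∎

  sum-extend : ∀ n m {h : ℕ → Carrier} → n N.≤ m → (∀ k → n N.≤ k → k N.< m → h k ≈ 0#)
             → sumTo R n h ≈ sumTo R m h
  sum-extend n m {h} n≤m z = begin
    sumTo R n h                                          ≈⟨ sym (+-identityʳ _) ⟩
    sumTo R n h + 0#                                     ≈⟨ +-congˡ (sym (sum-zero (m N.∸ n) tail-zero)) ⟩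
    sumTo R n h + sumTo R (m N.∸ n) (λ k → h (n N.+ k))  ≈⟨ sym (sum-split n (m N.∸ n) h) ⟩
    sumTo R (n N.+ (m N.∸ n)) h                          ≡⟨ P.cong (λ u → sumTo R u h) (NP.m+[n∸m]≡n n≤m) ⟩
    sumTo R m h                                          ∎
    where
    tail-zero : ∀ k → k N.< m N.∸ n → h (n N.+ k) ≈ 0#
    tail-zero k k< = z (n N.+ k) (NP.m≤m+n n k)
      (P.subst (λ u → n N.+ k N.< u) (NP.m+[n∸m]≡n n≤m) (NP.+-monoʳ-< n k<))

  sum-swap : ∀ m n (h : ℕ → ℕ → Carrier)
           → sumTo R m (λ i → sumTo R n (h i)) ≈ sumTo R n (λ j → sumTo R m (λ i → h i j))
  sum-swap zero    n h = sym (sum-zero n (λ _ _ → refl))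
  sum-swap (suc m) n h = trans (+-congʳ (sum-swap m n h)) (sym (sum-+ n _ _))

  sum-single : ∀ n p {h : ℕ → Carrier} → p N.< n → (∀ k → k N.< n → k ≢ p → h k ≈ 0#)
             → sumTo R n h ≈ h p
  sum-single (suc n) p {h} p<1+n z with NP.m≤n⇒m<n∨m≡n (NP.≤-pred p<1+n)
  ... | inj₁ p<n    = trans (+-cong (sum-single n p p<n (λ k k<n → z k (NP.m<n⇒m<1+n k<n)))
                                    (z n NP.≤-refl (λ e → NP.<-irrefl (P.sym e) p<n)))
                            (+-identityʳ _)
  ... | inj₂ P.refl = trans (+-congʳ (sum-zero n (λ k k<n → z k (NP.m<n⇒m<1+n k<n) (λ e → NP.<-irrefl e k<n))))
                            (+-identityˡ _)

  sum-pair : ∀ n p {h : ℕ → Carrier} → suc p N.< n → (∀ k → k N.< n → k ≢ p → k ≢ suc p → h k ≈ 0#)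
           → sumTo R n h ≈ h p + h (suc p)
  sum-pair (suc n) p {h} p+1<1+n z with NP.m≤n⇒m<n∨m≡n (NP.≤-pred p+1<1+n)
  ... | inj₁ p+1<n  = trans (+-cong (sum-pair n p p+1<n (λ k k<n → z k (NP.m<n⇒m<1+n k<n)))
                                    (z n NP.≤-refl (λ e → NP.<-irrefl (P.sym e) (NP.<-trans (NP.n<1+n p) p+1<n))
                                                   (λ e → NP.<-irrefl (P.sym e) p+1<n)))
                            (+-identityʳ _)
  ... | inj₂ P.refl = +-congʳ (sum-single (suc p) p NP.≤-refl (λ k k<n ne → z k (NP.m<n⇒m<1+n k<n) ne (λ e → NP.<-irrefl e k<n)))

  sum-rev : ∀ n (h : ℕ → Carrier) → sumTo R n h ≈ sumTo R n (λ k → h (n N.∸ suc k))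
  sum-rev zero    h = refl
  sum-rev (suc n) h = begin
    sumTo R n h + h n                                 ≈⟨ +-comm _ _ ⟩
    h n + sumTo R n h                                 ≈⟨ +-congˡ (sum-rev n h) ⟩
    h n + sumTo R n (λ k → h (n N.∸ suc k))           ≈⟨ sym (sum-front n _) ⟩
    sumTo R (suc n) (λ k → h (suc n N.∸ suc k))       ∎

  pow-+ : ∀ x m n → pow R x (m N.+ n) ≈ pow R x m * pow R x n
  pow-+ x zero    n = sym (*-identityˡ _)
  pow-+ x (suc m) n = trans (*-congˡ (pow-+ x m n)) (sym (*-assoc _ _ _))

  pow-* : ∀ x y n → pow R (x * y) n ≈ pow R x n * pow R y n
  pow-* x y zero    = sym (*-identityˡ _)
  pow-* x y (suc n) = trans (*-congˡ (pow-* x y n)) (middle x y (pow R x n) (pow R y n))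
    where
    open Solver
    middle : ∀ x y p q → (x * y) * (p * q) ≈ (x * p) * (y * q)
    middle = solve 4 (λ x y p q → ((x :* y) :* (p :* q)) := ((x :* p) :* (y :* q))) refl

-- Inserting a deleted column index back: punchIn j k is the k-th column
-- of a matrix once column j has been removed; punchOut j inverts it.
punchIn : ℕ → ℕ → ℕ
punchIn zero    k       = suc k
punchIn (suc j) zero    = zero
punchIn (suc j) (suc k) = suc (punchIn j k)

punchOut : ℕ → ℕ → ℕ
punchOut zero    zero    = zero
punchOut zero    (suc p) = p
punchOut (suc j) zero    = zero
punchOut (suc j) (suc p) = suc (punchOut j p)

toℕ-punchIn : ∀ {n} (j : Fin (suc n)) (k : Fin n) → toℕ (F.punchIn j k) ≡ punchIn (toℕ j) (toℕ k)
toℕ-punchIn F.zero    k         = P.refl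
toℕ-punchIn (F.suc j) F.zero    = P.refl
toℕ-punchIn (F.suc j) (F.suc k) = P.cong suc (toℕ-punchIn j k)

punchIn-punchOut : ∀ j p → j ≢ p → punchIn j (punchOut j p) ≡ p
punchIn-punchOut zero    zero    j≢p = ⊥-elim (j≢p P.refl)
punchIn-punchOut zero    (suc p) _   = P.refl
punchIn-punchOut (suc j) zero    _   = P.refl
punchIn-punchOut (suc j) (suc p) j≢p = P.cong suc (punchIn-punchOut j p (λ e → j≢p (P.cong suc e)))

punchOut-punchIn : ∀ j k → punchOut j (punchIn j k) ≡ k
punchOut-punchIn zero    k       = P.refl
punchOut-punchIn (suc j) zero    = P.refl
punchOut-punchIn (suc j) (suc k) = P.cong suc (punchOut-punchIn j k)

punchIn≢ : ∀ j k → punchIn j k ≢ j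
punchIn≢ zero    k       ()
punchIn≢ (suc j) zero    ()
punchIn≢ (suc j) (suc k) e = punchIn≢ j k (NP.suc-injective e)

punchOut< : ∀ n j p → j N.< suc n → p N.< suc n → j ≢ p → punchOut j p N.< n
punchOut< n       zero    zero    _       _       j≢p = ⊥-elim (j≢p P.refl)
punchOut< n       zero    (suc p) _       (s≤s p<) _  = p<
punchOut< (suc n) (suc j) zero    _       _       _   = z<s
punchOut< zero    (suc j) _       (s≤s ()) _      _
punchOut< (suc n) (suc j) (suc p) (s≤s j<) (s≤s p<) j≢p = s≤s (punchOut< n j p j< p< (λ e → j≢p (P.cong suc e)))

punchOut-suc : ∀ j p → j ≢ p → j ≢ suc p → punchOut j (suc p) ≡ suc (punchOut j p)
punchOut-suc zero          zero    j≢p _ = ⊥-elim (j≢p P.refl)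
punchOut-suc zero          (suc p) _   _ = P.refl
punchOut-suc (suc zero)    zero    _   e = ⊥-elim (e P.refl)
punchOut-suc (suc (suc j)) zero    _   _ = P.refl
punchOut-suc (suc j)       (suc p) ne ne′ = P.cong suc (punchOut-suc j p (λ e → ne (P.cong suc e)) (λ e → ne′ (P.cong suc e)))

punchIn-adjacent : ∀ p k → k ≢ p → punchIn p k ≡ punchIn (suc p) k
punchIn-adjacent zero    zero    k≢p = ⊥-elim (k≢p P.refl)
punchIn-adjacent zero    (suc k) _   = P.refl
punchIn-adjacent (suc p) zero    _   = P.refl
punchIn-adjacent (suc p) (suc k) k≢p = P.cong suc (punchIn-adjacent p k (λ e → k≢p (P.cong suc e)))

punchIn-self : ∀ p → punchIn p p ≡ suc p
punchIn-self zero    = P.refl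
punchIn-self (suc p) = P.cong suc (punchIn-self p)

punchIn-suc-self : ∀ p → punchIn (suc p) p ≡ p
punchIn-suc-self zero    = P.refl
punchIn-suc-self (suc p) = P.cong suc (punchIn-suc-self p)

punchIn-≥ : ∀ j k → j N.≤ k → punchIn j k ≡ suc k
punchIn-≥ zero    k       _         = P.refl
punchIn-≥ (suc j) (suc k) (s≤s j≤k) = P.cong suc (punchIn-≥ j k j≤k)

module Determinants {c ℓ} (R : CommutativeRing c ℓ) where
  open Basics R

  -- ℕ-indexed matrices; only finitely many entries ever matter
  Mat : Set c
  Mat = ℕ → ℕ → Carrier

  det′ : ℕ → Mat → Carrier
  det′ n M = det R n (λ i j → M (toℕ i) (toℕ j))

  sgn : ℕ → Carrier
  sgn = pow R (- 1#)

  minor : ℕ → Mat → Mat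
  minor j M i k = M (suc i) (punchIn j k)

  sumFin-cong : ∀ {n} {h g : Fin n → Carrier} → (∀ j → h j ≈ g j) → sumFin R h ≈ sumFin R g
  sumFin-cong {zero}  eq = refl
  sumFin-cong {suc n} eq = +-cong (eq F.zero) (sumFin-cong (λ j → eq (F.suc j)))

  sumFin-toℕ : ∀ n (h : ℕ → Carrier) → sumFin R {n} (λ j → h (toℕ j)) ≈ sumTo R n h
  sumFin-toℕ zero    h = refl
  sumFin-toℕ (suc n) h = trans (+-congˡ (sumFin-toℕ n (λ k → h (suc k)))) (sym (sum-front n h))

  expansionTerm : ∀ n → (Fin (suc n) → Fin (suc n) → Carrier) → Fin (suc n) → Carrier
  expansionTerm n M j = pow R (- 1#) (toℕ j) * (M F.zero j * det R n (λ i k → M (F.suc i) (F.punchIn j k)))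

  det-cong : ∀ n {M M′ : Fin n → Fin n → Carrier} → (∀ i j → M i j ≈ M′ i j) → det R n M ≈ det R n M′
  det-cong zero    eq = refl
  det-cong (suc n) {M} {M′} eq = sumFin-cong {h = expansionTerm n M} {g = expansionTerm n M′} (λ j → *-congˡ (*-cong (eq F.zero j) (det-cong n (λ i k → eq (F.suc i) (F.punchIn j k)))))

  det′-cong : ∀ n {M M′ : Mat} → (∀ i j → i N.< n → j N.< n → M i j ≈ M′ i j) → det′ n M ≈ det′ n M′
  det′-cong n eq = det-cong n (λ i j → eq (toℕ i) (toℕ j) (FP.toℕ<n i) (FP.toℕ<n j))

  det′-cong′ : ∀ n {M M′ : Mat} → (∀ i j → M i j ≈ M′ i j) → det′ n M ≈ det′ n M′
  det′-cong′ n eq = det′-cong n (λ i j _ _ → eq i j)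

  cofactorTerm : ℕ → Mat → ℕ → Carrier
  cofactorTerm n M j = sgn j * (M 0 j * det′ n (minor j M))

  laplace : ∀ n M → det′ (suc n) M ≈ sumTo R (suc n) (cofactorTerm n M)
  laplace n M = trans (sumFin-cong {h = expansionTerm n (λ i j → M (toℕ i) (toℕ j))} {g = λ j → cofactorTerm n M (toℕ j)} (λ j → *-congˡ (*-congˡ (det-cong n (λ i k → reflexive (P.cong (M (suc (toℕ i))) (toℕ-punchIn j k)))))))
                      (sumFin-toℕ (suc n) (cofactorTerm n M))

  det-linear : ∀ n p → p N.< n → (A B C : Mat) (α β : Carrier)
             → (∀ i l → l ≢ p → B i l ≈ A i l) → (∀ i l → l ≢ p → C i l ≈ A i l)
             → (∀ i → C i p ≈ α * A i p + β * B i p)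
             → det′ n C ≈ α * det′ n A + β * det′ n B
  det-linear (suc n) p p<n A B C α β B≈A C≈A Cp = begin
    det′ (suc n) C                                      ≈⟨ laplace n C ⟩
    sumTo R (suc n) (cofactorTerm n C)                  ≈⟨ sum-cong (suc n) termwise ⟩
    sumTo R (suc n) (λ j → α * cofactorTerm n A j + β * cofactorTerm n B j)
      ≈⟨ trans (sum-+ (suc n) _ _) (+-cong (sum-*ˡ (suc n) α _) (sum-*ˡ (suc n) β _)) ⟩
    α * sumTo R (suc n) (cofactorTerm n A) + β * sumTo R (suc n) (cofactorTerm n B)
      ≈⟨ sym (+-cong (*-congˡ (laplace n A)) (*-congˡ (laplace n B))) ⟩
    α * det′ (suc n) A + β * det′ (suc n) B             ∎
    where
    open Solver
    -- the two ways column p can enter a cofactor term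
    viaEntry : ∀ s x y D → s * ((α * x + β * y) * D) ≈ α * (s * (x * D)) + β * (s * (y * D))
    viaEntry s x y D = solve 6 (λ s x y α β D → (s :* ((α :* x :+ β :* y) :* D)) := (α :* (s :* (x :* D)) :+ β :* (s :* (y :* D)))) refl s x y α β D
    viaMinor : ∀ s x D E → s * (x * (α * D + β * E)) ≈ α * (s * (x * D)) + β * (s * (x * E))
    viaMinor s x D E = solve 6 (λ s x α β D E → (s :* (x :* (α :* D :+ β :* E))) := (α :* (s :* (x :* D)) :+ β :* (s :* (x :* E)))) refl s x α β D E

    termwise : ∀ j → j N.< suc n → cofactorTerm n C j ≈ α * cofactorTerm n A j + β * cofactorTerm n B j
    termwise j j< with j N.≟ p
    ... | yes P.refl = begin
      sgn j * (C 0 j * det′ n (minor j C))                 ≈⟨ *-congˡ (*-cong (Cp 0) (det′-cong′ n (λ i k → C≈A (suc i) (punchIn j k) (punchIn≢ j k)))) ⟩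
      sgn j * ((α * A 0 j + β * B 0 j) * det′ n (minor j A)) ≈⟨ viaEntry _ _ _ _ ⟩
      α * cofactorTerm n A j + β * (sgn j * (B 0 j * det′ n (minor j A)))
        ≈⟨ +-congˡ (*-congˡ (*-congˡ (*-congˡ (det′-cong′ n (λ i k → sym (B≈A (suc i) (punchIn j k) (punchIn≢ j k))))))) ⟩
      α * cofactorTerm n A j + β * cofactorTerm n B j      ∎
    ... | no j≢p = begin
      sgn j * (C 0 j * det′ n (minor j C))                 ≈⟨ *-congˡ (*-cong (C≈A 0 j j≢p) minorLinear) ⟩
      sgn j * (A 0 j * (α * det′ n (minor j A) + β * det′ n (minor j B))) ≈⟨ viaMinor _ _ _ _ ⟩
      α * cofactorTerm n A j + β * (sgn j * (A 0 j * det′ n (minor j B)))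
        ≈⟨ +-congˡ (*-congˡ (*-congˡ (*-congʳ (sym (B≈A 0 j j≢p))))) ⟩
      α * cofactorTerm n A j + β * cofactorTerm n B j      ∎
      where
      -- in the minor, the special column sits at position punchOut j p
      avoid : ∀ l → l ≢ punchOut j p → punchIn j l ≢ p
      avoid l l≢ e = l≢ (P.trans (P.sym (punchOut-punchIn j l)) (P.cong (punchOut j) e))
      minorLinear : det′ n (minor j C) ≈ α * det′ n (minor j A) + β * det′ n (minor j B)
      minorLinear = det-linear n (punchOut j p) (punchOut< n j p j< p<n j≢p) (minor j A) (minor j B) (minor j C) α β
        (λ i l l≢ → B≈A (suc i) (punchIn j l) (avoid l l≢))
        (λ i l l≢ → C≈A (suc i) (punchIn j l) (avoid l l≢))
        (λ i → P.subst (λ z → C (suc i) z ≈ α * A (suc i) z + β * B (suc i) z) (P.sym (punchIn-punchOut j p j≢p)) (Cp (suc i)))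

  det-additive : ∀ n p → p N.< n → (A B C : Mat)
               → (∀ i l → l ≢ p → B i l ≈ A i l) → (∀ i l → l ≢ p → C i l ≈ A i l)
               → (∀ i → C i p ≈ A i p + B i p)
               → det′ n C ≈ det′ n A + det′ n B
  det-additive n p p<n A B C B≈A C≈A Cp =
    trans (det-linear n p p<n A B C 1# 1# B≈A C≈A (λ i → trans (Cp i) (sym (+-cong (*-identityˡ _) (*-identityˡ _)))))
          (+-cong (*-identityˡ _) (*-identityˡ _))

  -- A matrix with two equal adjacent columns has determinant zero: in the
  -- Laplace expansion the terms j = p and j = p+1 cancel, and all other
  -- minors again have two equal adjacent columns.
  det-adjacent-equal : ∀ n p → suc p N.< n → (M : Mat) → (∀ i → M i p ≈ M i (suc p)) → det′ n M ≈ 0#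
  det-adjacent-equal (suc n) p p+1< M same = begin
    det′ (suc n) M                                          ≈⟨ laplace n M ⟩
    sumTo R (suc n) (cofactorTerm n M)                      ≈⟨ sum-pair (suc n) p p+1< otherTerms ⟩
    cofactorTerm n M p + cofactorTerm n M (suc p)
      ≈⟨ +-congˡ (*-cong (-1*x≈-x (sgn p)) (*-cong (sym (same 0)) (det′-cong′ n sameMinor))) ⟩
    sgn p * (M 0 p * det′ n (minor p M)) + (- sgn p) * (M 0 p * det′ n (minor p M)) ≈⟨ cancel _ _ ⟩
    0#                                                      ∎
    where
    open Solver
    cancel : ∀ s x → s * x + (- s) * x ≈ 0#
    cancel = solve 2 (λ s x → (s :* x :+ (:- s) :* x) := con (ℤ.+ 0)) refl
    sameMinor : ∀ i k → minor (suc p) M i k ≈ minor p M i k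
    sameMinor i k with k N.≟ p
    ... | yes P.refl = P.subst₂ (λ u v → M (suc i) u ≈ M (suc i) v) (P.sym (punchIn-suc-self k)) (P.sym (punchIn-self k)) (same (suc i))
    ... | no k≢p     = reflexive (P.cong (M (suc i)) (P.sym (punchIn-adjacent p k k≢p)))
    otherTerms : ∀ j → j N.< suc n → j ≢ p → j ≢ suc p → cofactorTerm n M j ≈ 0#
    otherTerms j j< j≢p j≢p+1 = trans (*-congˡ (*-congˡ minorZero)) (trans (*-congˡ (zeroʳ _)) (zeroʳ _))
      where
      p′ = punchOut j p
      at-p′ : punchIn j p′ ≡ p
      at-p′ = punchIn-punchOut j p j≢p
      at-p′+1 : punchIn j (suc p′) ≡ suc p
      at-p′+1 = P.trans (P.cong (punchIn j) (P.sym (punchOut-suc j p j≢p j≢p+1))) (punchIn-punchOut j (suc p) j≢p+1)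
      minorZero : det′ n (minor j M) ≈ 0#
      minorZero = det-adjacent-equal n p′
        (P.subst (λ z → z N.< n) (punchOut-suc j p j≢p j≢p+1) (punchOut< n j (suc p) j< p+1< j≢p+1))
        (minor j M) (λ i → P.subst₂ (λ u v → M (suc i) u ≈ M (suc i) v) (P.sym at-p′) (P.sym at-p′+1) (same (suc i)))

  setCol : ℕ → (ℕ → Carrier) → Mat → Mat
  setCol p u A i l with l N.≟ p
  ... | yes _ = u i
  ... | no _  = A i l

  setCol-≡ : ∀ p u A i → setCol p u A i p ≈ u i
  setCol-≡ p u A i with p N.≟ p
  ... | yes _  = refl
  ... | no p≢p = ⊥-elim (p≢p P.refl)

  setCol-≢ : ∀ p u A i l → l ≢ p → setCol p u A i l ≈ A i l
  setCol-≢ p u A i l l≢p with l N.≟ p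
  ... | yes l≡p = ⊥-elim (l≢p l≡p)
  ... | no _    = refl

  module AdjacentColumns (n p : ℕ) (p+1<n : suc p N.< n) (A : Mat) where
    private
      p<n : p N.< n
      p<n = NP.<-trans (NP.n<1+n p) p+1<n
      p+1≢p : suc p ≢ p
      p+1≢p e = NP.<-irrefl (P.sym e) (NP.n<1+n p)

    [_∣_] : (ℕ → Carrier) → (ℕ → Carrier) → Mat
    [ x ∣ y ] = setCol p x (setCol (suc p) y A)

    at-p : ∀ (x y : ℕ → Carrier) i → [ x ∣ y ] i p ≈ x i
    at-p x y = setCol-≡ p x (setCol (suc p) y A)

    at-p+1 : ∀ (x y : ℕ → Carrier) i → [ x ∣ y ] i (suc p) ≈ y i
    at-p+1 x y i = trans (setCol-≢ p x (setCol (suc p) y A) i (suc p) p+1≢p) (setCol-≡ (suc p) y A i)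

    elsewhere : ∀ (x y : ℕ → Carrier) i l → l ≢ p → l ≢ suc p → [ x ∣ y ] i l ≈ A i l
    elsewhere x y i l l≢p l≢p+1 = trans (setCol-≢ p x (setCol (suc p) y A) i l l≢p) (setCol-≢ (suc p) y A i l l≢p+1)

    as-bracket : ∀ (x y : ℕ → Carrier) (M : Mat) → (∀ i → M i p ≈ x i) → (∀ i → M i (suc p) ≈ y i)
               → (∀ i l → l ≢ p → l ≢ suc p → M i l ≈ A i l) → ∀ i l → M i l ≈ [ x ∣ y ] i l
    as-bracket x y M Mp Mp+1 Mo i l = cases (l N.≟ p) (l N.≟ suc p)
      where
      cases : Dec (l ≡ p) → Dec (l ≡ suc p) → M i l ≈ [ x ∣ y ] i l
      cases (yes l≡p) _ = P.subst (λ q → M i q ≈ [ x ∣ y ] i q) (P.sym l≡p) (trans (Mp i) (sym (at-p x y i)))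
      cases (no _)    (yes l≡p+1) = P.subst (λ q → M i q ≈ [ x ∣ y ] i q) (P.sym l≡p+1) (trans (Mp+1 i) (sym (at-p+1 x y i)))
      cases (no l≢p)  (no l≢p+1)  = trans (Mo i l l≢p l≢p+1) (sym (elsewhere x y i l l≢p l≢p+1))

    off-p : ∀ (x x′ y : ℕ → Carrier) i l → l ≢ p → [ x′ ∣ y ] i l ≈ [ x ∣ y ] i l
    off-p x x′ y i l l≢p = trans (setCol-≢ p x′ (setCol (suc p) y A) i l l≢p) (sym (setCol-≢ p x (setCol (suc p) y A) i l l≢p))

    off-p+1 : ∀ (x y y′ : ℕ → Carrier) i l → l ≢ suc p → [ x ∣ y′ ] i l ≈ [ x ∣ y ] i l
    off-p+1 x y y′ i l l≢p+1 = cases (l N.≟ p)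
      where
      cases : Dec (l ≡ p) → [ x ∣ y′ ] i l ≈ [ x ∣ y ] i l
      cases (yes l≡p) = P.subst (λ q → [ x ∣ y′ ] i q ≈ [ x ∣ y ] i q) (P.sym l≡p) (trans (at-p x y′ i) (sym (at-p x y i)))
      cases (no l≢p)  = trans (setCol-≢ p x (setCol (suc p) y′ A) i l l≢p)
                             (trans (setCol-≢ (suc p) y′ A i l l≢p+1)
                               (sym (trans (setCol-≢ p x (setCol (suc p) y A) i l l≢p) (setCol-≢ (suc p) y A i l l≢p+1))))

    additiveˡ : ∀ (x x′ y : ℕ → Carrier) → det′ n [ (λ i → x i + x′ i) ∣ y ] ≈ det′ n [ x ∣ y ] + det′ n [ x′ ∣ y ]
    additiveˡ x x′ y = det-additive n p p<n [ x ∣ y ] [ x′ ∣ y ] [ (λ i → x i + x′ i) ∣ y ]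
      (off-p x x′ y) (off-p x _ y) (λ i → trans (at-p _ y i) (sym (+-cong (at-p x y i) (at-p x′ y i))))

    additiveʳ : ∀ (x y y′ : ℕ → Carrier) → det′ n [ x ∣ (λ i → y i + y′ i) ] ≈ det′ n [ x ∣ y ] + det′ n [ x ∣ y′ ]
    additiveʳ x y y′ = det-additive n (suc p) p+1<n [ x ∣ y ] [ x ∣ y′ ] [ x ∣ (λ i → y i + y′ i) ]
      (off-p+1 x y y′) (off-p+1 x y _) (λ i → trans (at-p+1 x _ i) (sym (+-cong (at-p+1 x y i) (at-p+1 x y′ i))))

    repeated : ∀ (x : ℕ → Carrier) → det′ n [ x ∣ x ] ≈ 0#
    repeated x = det-adjacent-equal n p p+1<n [ x ∣ x ] (λ i → trans (at-p x x i) (sym (at-p+1 x x i)))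

    -- expanding 0 = det [ x+y ∣ x+y ] in both columns
    antisymmetric : ∀ (x y : ℕ → Carrier) → det′ n [ x ∣ y ] + det′ n [ y ∣ x ] ≈ 0#
    antisymmetric x y = begin
      det′ n [ x ∣ y ] + det′ n [ y ∣ x ]                              ≈⟨ sym (+-cong (+-identityˡ _) (+-identityʳ _)) ⟩
      (0# + det′ n [ x ∣ y ]) + (det′ n [ y ∣ x ] + 0#)                ≈⟨ sym (+-cong (+-congʳ (repeated x)) (+-congˡ (repeated y))) ⟩
      (det′ n [ x ∣ x ] + det′ n [ x ∣ y ]) + (det′ n [ y ∣ x ] + det′ n [ y ∣ y ])
        ≈⟨ sym (+-cong (additiveʳ x x y) (additiveʳ y x y)) ⟩
      det′ n [ x ∣ x+y ] + det′ n [ y ∣ x+y ]                          ≈⟨ sym (additiveˡ x y x+y) ⟩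
      det′ n [ x+y ∣ x+y ]                                             ≈⟨ repeated x+y ⟩
      0#                                                               ∎
      where
      x+y : ℕ → Carrier
      x+y i = x i + y i

  det-swap-adjacent : ∀ n p → suc p N.< n → (A B : Mat)
                    → (∀ i l → l ≢ p → l ≢ suc p → B i l ≈ A i l)
                    → (∀ i → B i p ≈ A i (suc p)) → (∀ i → B i (suc p) ≈ A i p)
                    → det′ n B ≈ - det′ n A
  det-swap-adjacent n p p+1<n A B B≈A Bp Bp+1 = inverseʳ-unique (det′ n A) (det′ n B) (begin
    det′ n A + det′ n B                     ≈⟨ +-cong (det′-cong′ n (as-bracket Ap Ap+1 A (λ _ → refl) (λ _ → refl) (λ _ _ _ _ → refl)))
                                                      (det′-cong′ n (as-bracket Ap+1 Ap B Bp Bp+1 B≈A)) ⟩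
    det′ n [ Ap ∣ Ap+1 ] + det′ n [ Ap+1 ∣ Ap ] ≈⟨ antisymmetric Ap Ap+1 ⟩
    0#                                      ∎)
    where
    open AdjacentColumns n p p+1<n A
    Ap Ap+1 : ℕ → Carrier
    Ap i   = A i p
    Ap+1 i = A i (suc p)

  -- Two equal columns p < q force determinant zero: swap column q with
  -- column q-1 until the equal columns are adjacent.
  det-equal-columns : ∀ n p q → p N.< q → q N.< n → (M : Mat) → (∀ i → M i p ≈ M i q) → det′ n M ≈ 0#
  det-equal-columns n p (suc q) p<q+1 q+1<n M same with NP.m≤n⇒m<n∨m≡n (NP.≤-pred p<q+1)
  ... | inj₂ P.refl = det-adjacent-equal n p q+1<n M same
  ... | inj₁ p<q    = begin
    det′ n M        ≈⟨ sym (-‿involutive _) ⟩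
    - (- det′ n M)  ≈⟨ -‿cong (sym (det-swap-adjacent n q q+1<n M B (elsewhere Mq+1 Mq) (at-p Mq+1 Mq) (at-p+1 Mq+1 Mq))) ⟩
    - det′ n B      ≈⟨ -‿cong (det-equal-columns n p q p<q (NP.<-trans (NP.n<1+n q) q+1<n) B sameB) ⟩
    - 0#            ≈⟨ -0#≈0# ⟩
    0#              ∎
    where
    open AdjacentColumns n q q+1<n M
    Mq Mq+1 : ℕ → Carrier
    Mq i   = M i q
    Mq+1 i = M i (suc q)
    B : Mat
    B = [ Mq+1 ∣ Mq ]
    sameB : ∀ i → B i p ≈ B i q
    sameB i = trans (elsewhere Mq+1 Mq i p (NP.<⇒≢ p<q) (NP.<⇒≢ (NP.m<n⇒m<1+n p<q))) (trans (same i) (sym (at-p Mq+1 Mq i)))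

  -- Adding to column p a linear combination of the earlier columns does
  -- not change the determinant (linearity in column p, then equal columns).
  det-add-earlier : ∀ n p → p N.< n → (A C : Mat) (v : ℕ → Carrier)
                  → (∀ i l → l ≢ p → C i l ≈ A i l)
                  → (∀ i → C i p ≈ A i p + sumTo R p (λ l → v l * A i l))
                  → det′ n C ≈ det′ n A
  det-add-earlier n p p<n A C v C≈A Cp = trans (det′-cong′ n asPartial) (partial p NP.≤-refl)
    where
    added : ℕ → ℕ → Carrier
    added k i = A i p + sumTo R k (λ l → v l * A i l)

    partial : ∀ k → k N.≤ p → det′ n (setCol p (added k) A) ≈ det′ n A
    partial zero    _   = det′-cong′ n noneAdded
      where
      noneAdded : ∀ i l → setCol p (added 0) A i l ≈ A i l
      noneAdded i l = cases (l N.≟ p)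
        where
        cases : Dec (l ≡ p) → setCol p (added 0) A i l ≈ A i l
        cases (yes l≡p) = P.subst (λ q → setCol p (added 0) A i q ≈ A i q) (P.sym l≡p) (trans (setCol-≡ p _ A i) (+-identityʳ _))
        cases (no l≢p)  = setCol-≢ p _ A i l l≢p
    partial (suc k) k<p = begin
      det′ n (setCol p (added (suc k)) A)                  ≈⟨ det-linear n p p<n Ck Dk (setCol p (added (suc k)) A) 1# (v k)
                                                                (λ i l l≢p → trans (setCol-≢ p _ A i l l≢p) (sym (setCol-≢ p _ A i l l≢p)))
                                                                (λ i l l≢p → trans (setCol-≢ p _ A i l l≢p) (sym (setCol-≢ p _ A i l l≢p)))
                                                                newColumn ⟩
      1# * det′ n Ck + v k * det′ n Dk                     ≈⟨ +-cong (*-identityˡ _) (*-congˡ DkZero) ⟩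
      det′ n Ck + v k * 0#                                 ≈⟨ trans (+-congˡ (zeroʳ _)) (+-identityʳ _) ⟩
      det′ n Ck                                            ≈⟨ partial k (NP.<⇒≤ k<p) ⟩
      det′ n A                                             ∎
      where
      Ak : ℕ → Carrier
      Ak i = A i k
      Ck Dk : Mat
      Ck = setCol p (added k) A
      Dk = setCol p Ak A
      newColumn : ∀ i → setCol p (added (suc k)) A i p ≈ 1# * Ck i p + v k * Dk i p
      newColumn i = trans (setCol-≡ p _ A i)
        (trans (sym (+-assoc _ _ _)) (sym (+-cong (trans (*-identityˡ _) (setCol-≡ p _ A i)) (*-congˡ (setCol-≡ p _ A i)))))
      DkZero : det′ n Dk ≈ 0#
      DkZero = det-equal-columns n k p k<p p<n Dk
        (λ i → trans (setCol-≢ p Ak A i k (NP.<⇒≢ k<p)) (sym (setCol-≡ p Ak A i)))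

    asPartial : ∀ i l → C i l ≈ setCol p (added p) A i l
    asPartial i l = cases (l N.≟ p)
      where
      cases : Dec (l ≡ p) → C i l ≈ setCol p (added p) A i l
      cases (yes l≡p) = P.subst (λ q → C i q ≈ setCol p (added p) A i q) (P.sym l≡p) (trans (Cp i) (sym (setCol-≡ p _ A i)))
      cases (no l≢p)  = trans (C≈A i l l≢p) (sym (setCol-≢ p _ A i l l≢p))

  -- Y·V for V upper triangular (the entries V l j with l > j are not used)
  mulU : Mat → Mat → Mat
  mulU Y V i j = sumTo R (suc j) (λ l → Y i l * V l j)

  -- L·Y for L lower triangular (the entries L i k with k > i are not used)
  mulL : Mat → Mat → Mat
  mulL L Y i j = sumTo R (suc i) (λ k → L i k * Y k j)

  -- Right multiplication by an upper unitriangular matrix preserves the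
  -- determinant: it is the composite of the column operations "add
  -- Σ_{l<m} V l m · (column l) to column m", for m = 0, 1, ..., n-1.
  det-mulU : ∀ n (Y V : Mat) → (∀ j → V j j ≈ 1#) → det′ n (mulU Y V) ≈ det′ n Y
  det-mulU n Y V Vdiag = begin
    det′ n (mulU Y V)  ≈⟨ sym (det′-cong′ n (λ i j → halfway-≥ 0 i j z≤n)) ⟩
    det′ n (halfway 0) ≈⟨ allSteps n NP.≤-refl ⟩
    det′ n (halfway n) ≈⟨ det′-cong n (λ i j _ j<n → halfway-< n i j j<n) ⟩
    det′ n Y           ∎
    where
    halfway : ℕ → Mat
    halfway m i j with m N.≤? j
    ... | yes _ = mulU Y V i j
    ... | no _  = Y i j

    halfway-≥ : ∀ m i j → m N.≤ j → halfway m i j ≈ mulU Y V i j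
    halfway-≥ m i j m≤j with m N.≤? j
    ... | yes _  = refl
    ... | no m≰j = ⊥-elim (m≰j m≤j)

    halfway-< : ∀ m i j → j N.< m → halfway m i j ≈ Y i j
    halfway-< m i j j<m with m N.≤? j
    ... | yes m≤j = ⊥-elim (NP.<-irrefl P.refl (NP.<-≤-trans j<m m≤j))
    ... | no _    = refl

    oneStep : ∀ m → m N.< n → det′ n (halfway m) ≈ det′ n (halfway (suc m))
    oneStep m m<n = det-add-earlier n m m<n (halfway (suc m)) (halfway m) (λ l → V l m) otherColumns columnM
      where
      otherColumns : ∀ i l → l ≢ m → halfway m i l ≈ halfway (suc m) i l
      otherColumns i l l≢m with NP.<-cmp l m
      ... | tri< l<m _ _ = trans (halfway-< m i l l<m) (sym (halfway-< (suc m) i l (NP.m<n⇒m<1+n l<m)))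
      ... | tri≈ _ l≡m _ = ⊥-elim (l≢m l≡m)
      ... | tri> _ _ m<l = trans (halfway-≥ m i l (NP.<⇒≤ m<l)) (sym (halfway-≥ (suc m) i l m<l))
      columnM : ∀ i → halfway m i m ≈ halfway (suc m) i m + sumTo R m (λ l → V l m * halfway (suc m) i l)
      columnM i = begin
        halfway m i m                                            ≈⟨ halfway-≥ m i m NP.≤-refl ⟩
        sumTo R m (λ l → Y i l * V l m) + Y i m * V m m
          ≈⟨ +-cong (sum-cong m (λ l l<m → trans (*-comm _ _) (*-congˡ (sym (halfway-< (suc m) i l (NP.m<n⇒m<1+n l<m))))))
                    (trans (*-congˡ (Vdiag m)) (*-identityʳ _)) ⟩
        sumTo R m (λ l → V l m * halfway (suc m) i l) + Y i m   ≈⟨ +-comm _ _ ⟩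
        Y i m + sumTo R m (λ l → V l m * halfway (suc m) i l)   ≈⟨ +-congʳ (sym (halfway-< (suc m) i m NP.≤-refl)) ⟩
        halfway (suc m) i m + sumTo R m (λ l → V l m * halfway (suc m) i l) ∎

    allSteps : ∀ k → k N.≤ n → det′ n (halfway 0) ≈ det′ n (halfway k)
    allSteps zero    _     = refl
    allSteps (suc k) k<n = trans (allSteps k (NP.<⇒≤ k<n)) (oneStep k k<n)

  det₁ : ∀ M → det′ 1 M ≈ M 0 0
  det₁ M = trans (laplace 0 M) (trans (+-identityˡ _) (trans (*-identityˡ _) (*-identityʳ _)))

  det₂ : ∀ M → det′ 2 M ≈ M 0 0 * M 1 1 - M 0 1 * M 1 0
  det₂ M = trans (laplace 1 M)
    (trans (+-cong (+-congˡ (*-congˡ (*-congˡ (det₁ (minor 0 M))))) (*-congˡ (*-congˡ (det₁ (minor 1 M)))))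
           (expand (M 0 0) (M 0 1) (M 1 0) (M 1 1)))
    where
    open Solver
    expand : ∀ a b c d → (0# + 1# * (a * d)) + (- 1# * 1#) * (b * c) ≈ a * d - b * c
    expand = solve 4 (λ a b c d → ((con (ℤ.+ 0) :+ con (ℤ.+ 1) :* (a :* d)) :+ (con ℤ.-[1+ 0 ] :* con (ℤ.+ 1)) :* (b :* c))
                                  := (a :* d :- b :* c)) refl

  det₃ : ∀ M → det′ 3 M ≈ M 0 0 * (M 1 1 * M 2 2 - M 1 2 * M 2 1) - M 0 1 * (M 1 0 * M 2 2 - M 1 2 * M 2 0)
                          + M 0 2 * (M 1 0 * M 2 1 - M 1 1 * M 2 0)
  det₃ M = trans (laplace 2 M)
    (trans (+-cong (+-cong (+-congˡ (*-congˡ (*-congˡ (det₂ (minor 0 M))))) (*-congˡ (*-congˡ (det₂ (minor 1 M)))))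
                   (*-congˡ (*-congˡ (det₂ (minor 2 M)))))
           (expand (M 0 0) (M 0 1) (M 0 2) (M 1 0) (M 1 1) (M 1 2) (M 2 0) (M 2 1) (M 2 2)))
    where
    open Solver
    expand : ∀ a b c d e f g h i
           → ((0# + 1# * (a * (e * i - f * h))) + (- 1# * 1#) * (b * (d * i - f * g))) + (- 1# * (- 1# * 1#)) * (c * (d * h - e * g))
             ≈ a * (e * i - f * h) - b * (d * i - f * g) + c * (d * h - e * g)
    expand = solve 9 (λ a b c d e f g h i →
      (((con (ℤ.+ 0) :+ con (ℤ.+ 1) :* (a :* (e :* i :- f :* h))) :+ (con ℤ.-[1+ 0 ] :* con (ℤ.+ 1)) :* (b :* (d :* i :- f :* g)))
        :+ (con ℤ.-[1+ 0 ] :* (con ℤ.-[1+ 0 ] :* con (ℤ.+ 1))) :* (c :* (d :* h :- e :* g)))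
      := (a :* (e :* i :- f :* h) :- b :* (d :* i :- f :* g) :+ c :* (d :* h :- e :* g))) refl

  det-scale : ∀ m x M → det′ m (λ i j → x * M i j) ≈ pow R x m * det′ m M
  det-scale zero    x M = sym (*-identityʳ _)
  det-scale (suc m) x M = begin
    det′ (suc m) (λ i j → x * M i j)                    ≈⟨ laplace m (λ i j → x * M i j) ⟩
    sumTo R (suc m) (cofactorTerm m (λ i j → x * M i j))
      ≈⟨ sum-cong′ (suc m) (λ j → trans (*-congˡ (*-congˡ (det-scale m x (minor j M)))) (regroup _ _ _ _ _)) ⟩
    sumTo R (suc m) (λ j → (x * pow R x m) * cofactorTerm m M j) ≈⟨ sum-*ˡ (suc m) _ _ ⟩
    (x * pow R x m) * sumTo R (suc m) (cofactorTerm m M) ≈⟨ *-congˡ (sym (laplace m M)) ⟩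
    pow R x (suc m) * det′ (suc m) M                    ∎
    where
    open Solver
    regroup : ∀ s x y p D → s * ((x * y) * (p * D)) ≈ (x * p) * (s * (y * D))
    regroup = solve 5 (λ s x y p D → (s :* ((x :* y) :* (p :* D))) := ((x :* p) :* (s :* (y :* D)))) refl

  shift : ℕ → Mat → Mat
  shift k Y i j = Y (k N.+ i) (k N.+ j)

  det-block : ∀ k m Y → (∀ i j → i N.< k → k N.≤ j → Y i j ≈ 0#)
            → det′ (k N.+ m) Y ≈ det′ k Y * det′ m (shift k Y)
  det-block zero    m Y _    = sym (*-identityˡ _)
  det-block (suc k) m Y upperZero = begin
    det′ (suc k N.+ m) Y                                       ≈⟨ laplace (k N.+ m) Y ⟩
    sumTo R (suc k N.+ m) (cofactorTerm (k N.+ m) Y)           ≈⟨ sum-split (suc k) m _ ⟩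
    sumTo R (suc k) (cofactorTerm (k N.+ m) Y) + sumTo R m (λ j → cofactorTerm (k N.+ m) Y (suc k N.+ j))
      ≈⟨ +-cong (sum-cong (suc k) leftTerm) (sum-zero m (λ j _ → rightTerm j)) ⟩
    sumTo R (suc k) (λ j → cofactorTerm k Y j * D) + 0#         ≈⟨ trans (+-identityʳ _) (sum-*ʳ (suc k) D _) ⟩
    sumTo R (suc k) (cofactorTerm k Y) * D                      ≈⟨ *-congʳ (sym (laplace k Y)) ⟩
    det′ (suc k) Y * D                                          ∎
    where
    D = det′ m (shift (suc k) Y)
    rightTerm : ∀ j → cofactorTerm (k N.+ m) Y (suc k N.+ j) ≈ 0#
    rightTerm j = trans (*-congˡ (trans (*-congʳ (upperZero 0 (suc k N.+ j) z<s (NP.m≤m+n (suc k) j))) (zeroˡ _))) (zeroʳ _)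
    -- a minor for a left-block column is again block triangular
    leftTerm : ∀ j → j N.< suc k → cofactorTerm (k N.+ m) Y j ≈ cofactorTerm k Y j * D
    leftTerm j j< = begin
      sgn j * (Y 0 j * det′ (k N.+ m) (minor j Y))                          ≈⟨ *-congˡ (*-congˡ minorBlock) ⟩
      sgn j * (Y 0 j * (det′ k (minor j Y) * det′ m (shift k (minor j Y)))) ≈⟨ *-congˡ (*-congˡ (*-congˡ (det′-cong′ m sameBlock))) ⟩
      sgn j * (Y 0 j * (det′ k (minor j Y) * D))                            ≈⟨ regroup _ _ _ _ ⟩
      cofactorTerm k Y j * D                                                ∎
      where
      j≤k : j N.≤ k
      j≤k = NP.≤-pred j<
      minorBlock = det-block k m (minor j Y) (λ i l i< k≤ →
        P.subst (λ z → Y (suc i) z ≈ 0#) (P.sym (punchIn-≥ j l (NP.≤-trans j≤k k≤))) (upperZero (suc i) (suc l) (s≤s i<) (s≤s k≤)))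
      sameBlock : ∀ a b → shift k (minor j Y) a b ≈ shift (suc k) Y a b
      sameBlock a b = reflexive (P.cong (Y (suc (k N.+ a))) (punchIn-≥ j (k N.+ b) (NP.≤-trans j≤k (NP.m≤m+n k b))))
      open Solver
      regroup : ∀ s y d e → s * (y * (d * e)) ≈ (s * (y * d)) * e
      regroup = solve 4 (λ s y d e → (s :* (y :* (d :* e))) := ((s :* (y :* d)) :* e)) refl

module Triangular {c ℓ} (R : CommutativeRing c ℓ) where
  open Basics R
  open Determinants R

  LowerUni : Mat → Set ℓ
  LowerUni L = (∀ i → L i i ≈ 1#) × (∀ i k → i N.< k → L i k ≈ 0#)

  mulL-cong : ∀ L {Y Y′ : Mat} → (∀ i j → Y i j ≈ Y′ i j) → ∀ i j → mulL L Y i j ≈ mulL L Y′ i j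
  mulL-cong L eq i j = sum-cong′ (suc i) (λ k → *-congˡ (eq k j))

  mulL-mulU : ∀ L Z V i j → mulU (mulL L Z) V i j ≈ mulL L (mulU Z V) i j
  mulL-mulU L Z V i j = begin
    sumTo R (suc j) (λ l → sumTo R (suc i) (λ k → L i k * Z k l) * V l j)
      ≈⟨ sum-cong′ (suc j) (λ l → sym (sum-*ʳ (suc i) (V l j) _)) ⟩
    sumTo R (suc j) (λ l → sumTo R (suc i) (λ k → (L i k * Z k l) * V l j))  ≈⟨ sum-swap (suc j) (suc i) _ ⟩
    sumTo R (suc i) (λ k → sumTo R (suc j) (λ l → (L i k * Z k l) * V l j))
      ≈⟨ sum-cong′ (suc i) (λ k → trans (sum-cong′ (suc j) (λ l → *-assoc _ _ _)) (sum-*ˡ (suc j) (L i k) _)) ⟩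
    sumTo R (suc i) (λ k → L i k * sumTo R (suc j) (λ l → Z k l * V l j))    ∎

  mulL-mulL : ∀ L₁ L₂ Z → (∀ i k → i N.< k → L₂ i k ≈ 0#) → ∀ i j → mulL L₁ (mulL L₂ Z) i j ≈ mulL (mulL L₁ L₂) Z i j
  mulL-mulL L₁ L₂ Z L₂-lower i j = begin
    sumTo R (suc i) (λ k → L₁ i k * sumTo R (suc k) (λ k′ → L₂ k k′ * Z k′ j))
      ≈⟨ sum-cong (suc i) (λ k k< → *-congˡ (sum-extend (suc k) (suc i) k< (λ k′ k<k′ _ → trans (*-congʳ (L₂-lower k k′ k<k′)) (zeroˡ _)))) ⟩
    sumTo R (suc i) (λ k → L₁ i k * sumTo R (suc i) (λ k′ → L₂ k k′ * Z k′ j))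
      ≈⟨ sum-cong′ (suc i) (λ k → trans (sym (sum-*ˡ (suc i) _ _)) (sum-cong′ (suc i) (λ k′ → sym (*-assoc _ _ _)))) ⟩
    sumTo R (suc i) (λ k → sumTo R (suc i) (λ k′ → (L₁ i k * L₂ k k′) * Z k′ j)) ≈⟨ sum-swap (suc i) (suc i) _ ⟩
    sumTo R (suc i) (λ k′ → sumTo R (suc i) (λ k → (L₁ i k * L₂ k k′) * Z k′ j)) ≈⟨ sum-cong′ (suc i) (λ k′ → sum-*ʳ (suc i) _ _) ⟩
    sumTo R (suc i) (λ k′ → mulL L₁ L₂ i k′ * Z k′ j)                          ∎

  LowerUni-mul : ∀ L₁ L₂ → LowerUni L₁ → LowerUni L₂ → LowerUni (mulL L₁ L₂)
  LowerUni-mul L₁ L₂ (diag₁ , lower₁) (diag₂ , lower₂) = diag , lower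
    where
    diag : ∀ i → mulL L₁ L₂ i i ≈ 1#
    diag i = trans (sum-single (suc i) i NP.≤-refl (λ k k< k≢i → trans (*-congˡ (lower₂ k i (NP.≤∧≢⇒< (NP.≤-pred k<) k≢i))) (zeroʳ _)))
                   (trans (*-cong (diag₁ i) (diag₂ i)) (*-identityˡ _))
    lower : ∀ i k → i N.< k → mulL L₁ L₂ i k ≈ 0#
    lower i k i<k = sum-zero (suc i) (λ k′ k′< → trans (*-congˡ (lower₂ k′ k (NP.≤-<-trans (NP.≤-pred k′<) i<k))) (zeroʳ _))

  LowerUni-shift : ∀ m L → LowerUni L → LowerUni (shift m L)
  LowerUni-shift m L (diag , lower) = (λ i → diag (m N.+ i)) , (λ i k i<k → lower (m N.+ i) (m N.+ k) (NP.+-monoʳ-< m i<k))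

  mulL-upperZero : ∀ m L Y → (∀ i j → i N.< m → m N.≤ j → Y i j ≈ 0#) → ∀ i j → i N.< m → m N.≤ j → mulL L Y i j ≈ 0#
  mulL-upperZero m L Y upperZero i j i<m m≤j =
    sum-zero (suc i) (λ k k< → trans (*-congˡ (upperZero k j (NP.≤-<-trans (NP.≤-pred k<) i<m) m≤j)) (zeroʳ _))

  mulL-shift : ∀ m L Y → (∀ i j → i N.< m → m N.≤ j → Y i j ≈ 0#) → ∀ i j → shift m (mulL L Y) i j ≈ mulL (shift m L) (shift m Y) i j
  mulL-shift m L Y upperZero i j = begin
    sumTo R (suc (m N.+ i)) (λ k → L (m N.+ i) k * Y k (m N.+ j))
      ≡⟨ P.cong (λ u → sumTo R u (λ k → L (m N.+ i) k * Y k (m N.+ j))) (P.sym (NP.+-suc m i)) ⟩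
    sumTo R (m N.+ suc i) (λ k → L (m N.+ i) k * Y k (m N.+ j))   ≈⟨ sum-split m (suc i) _ ⟩
    sumTo R m (λ k → L (m N.+ i) k * Y k (m N.+ j)) + sumTo R (suc i) (λ k → L (m N.+ i) (m N.+ k) * Y (m N.+ k) (m N.+ j))
      ≈⟨ +-congʳ (sum-zero m (λ k k<m → trans (*-congˡ (upperZero k (m N.+ j) k<m (NP.m≤m+n m j))) (zeroʳ _))) ⟩
    0# + sumTo R (suc i) (λ k → L (m N.+ i) (m N.+ k) * Y (m N.+ k) (m N.+ j)) ≈⟨ +-identityˡ _ ⟩
    mulL (shift m L) (shift m Y) i j                              ∎

  -- Leading minors of size ≤ 3 are unchanged by left multiplication with
  -- a lower unitriangular matrix (a row operation), by direct expansion.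
  det₁-mulL : ∀ L Y → LowerUni L → det′ 1 (mulL L Y) ≈ det′ 1 Y
  det₁-mulL L Y (diag , _) = trans (det₁ (mulL L Y)) (trans (trans (+-identityˡ _) (trans (*-congʳ (diag 0)) (*-identityˡ _))) (sym (det₁ Y)))

  private
    module Rows (L Y : Mat) (diag : ∀ i → L i i ≈ 1#) where
      row₀ : ∀ j → mulL L Y 0 j ≈ Y 0 j
      row₀ j = trans (+-identityˡ _) (trans (*-congʳ (diag 0)) (*-identityˡ _))
      row₁ : ∀ j → mulL L Y 1 j ≈ L 1 0 * Y 0 j + Y 1 j
      row₁ j = trans (+-congʳ (+-identityˡ _)) (+-congˡ (trans (*-congʳ (diag 1)) (*-identityˡ _)))
      row₂ : ∀ j → mulL L Y 2 j ≈ L 2 0 * Y 0 j + L 2 1 * Y 1 j + Y 2 j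
      row₂ j = trans (+-congʳ (+-congʳ (+-identityˡ _))) (+-congˡ (trans (*-congʳ (diag 2)) (*-identityˡ _)))

  det₂-mulL : ∀ L Y → LowerUni L → det′ 2 (mulL L Y) ≈ det′ 2 Y
  det₂-mulL L Y (diag , _) = begin
    det′ 2 (mulL L Y)                                           ≈⟨ det₂ (mulL L Y) ⟩
    M′ 0 0 * M′ 1 1 - M′ 0 1 * M′ 1 0                           ≈⟨ +-cong (*-cong (row₀ 0) (row₁ 1)) (-‿cong (*-cong (row₀ 1) (row₁ 0))) ⟩
    Y 0 0 * (L 1 0 * Y 0 1 + Y 1 1) - Y 0 1 * (L 1 0 * Y 0 0 + Y 1 0)
      ≈⟨ solve 5 (λ l a b c d → (a :* (l :* b :+ d) :- b :* (l :* a :+ c)) := (a :* d :- b :* c)) refl (L 1 0) (Y 0 0) (Y 0 1) (Y 1 0) (Y 1 1) ⟩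
    Y 0 0 * Y 1 1 - Y 0 1 * Y 1 0                               ≈⟨ sym (det₂ Y) ⟩
    det′ 2 Y                                                    ∎
    where
    open Solver
    open Rows L Y diag
    M′ = mulL L Y

  det₃-mulL : ∀ L Y → LowerUni L → det′ 3 (mulL L Y) ≈ det′ 3 Y
  det₃-mulL L Y (diag , _) = trans (det₃ (mulL L Y)) (trans rows (trans expand (sym (det₃ Y))))
    where
    open Solver
    open Rows L Y diag
    M′ = mulL L Y
    p = L 1 0
    q = L 2 0
    r = L 2 1
    rows : M′ 0 0 * (M′ 1 1 * M′ 2 2 - M′ 1 2 * M′ 2 1) - M′ 0 1 * (M′ 1 0 * M′ 2 2 - M′ 1 2 * M′ 2 0)
             + M′ 0 2 * (M′ 1 0 * M′ 2 1 - M′ 1 1 * M′ 2 0)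
           ≈ Y 0 0 * ((p * Y 0 1 + Y 1 1) * (q * Y 0 2 + r * Y 1 2 + Y 2 2) - (p * Y 0 2 + Y 1 2) * (q * Y 0 1 + r * Y 1 1 + Y 2 1))
             - Y 0 1 * ((p * Y 0 0 + Y 1 0) * (q * Y 0 2 + r * Y 1 2 + Y 2 2) - (p * Y 0 2 + Y 1 2) * (q * Y 0 0 + r * Y 1 0 + Y 2 0))
             + Y 0 2 * ((p * Y 0 0 + Y 1 0) * (q * Y 0 1 + r * Y 1 1 + Y 2 1) - (p * Y 0 1 + Y 1 1) * (q * Y 0 0 + r * Y 1 0 + Y 2 0))
    rows = +-cong (+-cong (*-cong (row₀ 0) (+-cong (*-cong (row₁ 1) (row₂ 2)) (-‿cong (*-cong (row₁ 2) (row₂ 1)))))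
                          (-‿cong (*-cong (row₀ 1) (+-cong (*-cong (row₁ 0) (row₂ 2)) (-‿cong (*-cong (row₁ 2) (row₂ 0)))))))
                  (*-cong (row₀ 2) (+-cong (*-cong (row₁ 0) (row₂ 1)) (-‿cong (*-cong (row₁ 1) (row₂ 0)))))
    expand = solve 12 (λ p q r y00 y01 y02 y10 y11 y12 y20 y21 y22 →
      (y00 :* ((p :* y01 :+ y11) :* (q :* y02 :+ r :* y12 :+ y22) :- (p :* y02 :+ y12) :* (q :* y01 :+ r :* y11 :+ y21))
       :- y01 :* ((p :* y00 :+ y10) :* (q :* y02 :+ r :* y12 :+ y22) :- (p :* y02 :+ y12) :* (q :* y00 :+ r :* y10 :+ y20))
       :+ y02 :* ((p :* y00 :+ y10) :* (q :* y01 :+ r :* y11 :+ y21) :- (p :* y01 :+ y11) :* (q :* y00 :+ r :* y10 :+ y20)))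
      := (y00 :* (y11 :* y22 :- y12 :* y21) :- y01 :* (y10 :* y22 :- y12 :* y20) :+ y02 :* (y10 :* y21 :- y11 :* y20)))
      refl p q r (Y 0 0) (Y 0 1) (Y 0 2) (Y 1 0) (Y 1 1) (Y 1 2) (Y 2 0) (Y 2 1) (Y 2 2)

  toeplitz : (ℕ → Carrier) → Mat
  toeplitz h i k with k N.≤? i
  ... | yes _ = h (i N.∸ k)
  ... | no _  = 0#

  toeplitzᵀ : (ℕ → Carrier) → Mat
  toeplitzᵀ h l j = toeplitz h j l

  toeplitz-≤ : ∀ h i k → k N.≤ i → toeplitz h i k ≈ h (i N.∸ k)
  toeplitz-≤ h i k k≤i with k N.≤? i
  ... | yes _  = refl
  ... | no k≰i = ⊥-elim (k≰i k≤i)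

  toeplitz-> : ∀ h i k → i N.< k → toeplitz h i k ≈ 0#
  toeplitz-> h i k i<k with k N.≤? i
  ... | yes k≤i = ⊥-elim (NP.<-irrefl P.refl (NP.<-≤-trans i<k k≤i))
  ... | no _    = refl

  toeplitz-lowerUni : ∀ h → h 0 ≈ 1# → LowerUni (toeplitz h)
  toeplitz-lowerUni h h0 = (λ i → trans (toeplitz-≤ h i i NP.≤-refl) (trans (reflexive (P.cong h (NP.n∸n≡0 i))) h0))
                         , (λ i k i<k → toeplitz-> h i k i<k)

  mulU-toeplitzᵀ : ∀ Z h i j → mulU Z (toeplitzᵀ h) i j ≈ sumTo R (suc j) (λ l → Z i l * h (j N.∸ l))
  mulU-toeplitzᵀ Z h i j = sum-cong (suc j) (λ l l< → *-congˡ (toeplitz-≤ h j l (NP.≤-pred l<)))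

  mulL-toeplitz : ∀ h Z i j → mulL (toeplitz h) Z i j ≈ sumTo R (suc i) (λ k → h (i N.∸ k) * Z k j)
  mulL-toeplitz h Z i j = sum-cong (suc i) (λ k k< → *-congʳ (toeplitz-≤ h i k (NP.≤-pred k<)))

-- the index arithmetic behind reversing a convolution
reversed-index : ∀ i k j → k N.≤ i → suc i N.+ j N.∸ (i N.∸ k) ≡ suc (k N.+ j)
reversed-index i k j k≤i = P.trans (P.cong (N._∸ (i N.∸ k)) split) (NP.m+n∸m≡n (i N.∸ k) (suc (k N.+ j)))
  where
  split : suc i N.+ j ≡ (i N.∸ k) N.+ suc (k N.+ j)
  split = P.sym (P.trans (NP.+-suc (i N.∸ k) (k N.+ j))
                  (P.cong suc (P.trans (P.sym (NP.+-assoc (i N.∸ k) k j)) (P.cong (N._+ j) (NP.m∸n+n≡m k≤i)))))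

module SeriesF3 {c ℓ} (R : CommutativeRing c ℓ) (a b : CommutativeRing.Carrier R)
                (f : Series R) (isF : IsF3 R a b f) where
  open Basics R
  open Determinants R
  open Triangular R

  δ : ℕ → Carrier
  δ = oneS R

  f-0 : f 0 ≈ 1#
  f-0 = trans (isF 0) (solve 2 (λ a b → (con (ℤ.+ 1) :+ (a :* con (ℤ.+ 0) :+ b :* con (ℤ.+ 0))) := con (ℤ.+ 1)) refl a b)
    where open Solver

  f-suc : ∀ n → f (suc n) ≈ a * f n + b * zS R (zS R (mulS R f f)) n
  f-suc n = trans (isF (suc n)) (+-identityˡ _)

  f-1 : f 1 ≈ a
  f-1 = trans (f-suc 0) (trans (+-cong (*-congˡ f-0) (zeroʳ _)) (trans (+-identityʳ _) (*-identityʳ _)))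

  f-2 : f 2 ≈ a * a
  f-2 = trans (f-suc 1) (trans (+-cong (*-congˡ f-1) (zeroʳ _)) (+-identityʳ _))

  f-3 : f 3 ≈ a * (a * a) + b
  f-3 = trans (f-suc 2) (+-cong (*-congˡ f-2) (trans (*-congˡ (trans (+-identityˡ _) (trans (*-cong f-0 f-0) (*-identityˡ _)))) (*-identityʳ _)))

  f-+3 : ∀ m → f (3 N.+ m) ≈ a * f (2 N.+ m) + b * mulS R f f m
  f-+3 m = f-suc (2 N.+ m)

  -- the inverse series w = 1/f = 1 - a z - b z³ f
  w : Series R
  w 0                   = 1#
  w 1                   = - a
  w 2                   = 0#
  w (suc (suc (suc n))) = - (b * f n)

  f*w≈1 : ∀ n → mulS R f w n ≈ δ n
  f*w≈1 zero = trans (+-identityˡ _) (trans (*-identityʳ _) f-0)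
  f*w≈1 (suc zero) = trans (+-cong (+-identityˡ _) (*-identityʳ _))
    (trans (+-cong (*-congʳ f-0) f-1) (solve 1 (λ a → (con (ℤ.+ 1) :* (:- a) :+ a) := con (ℤ.+ 0)) refl a))
    where open Solver
  f*w≈1 (suc (suc zero)) = trans (+-cong (+-cong (trans (+-identityˡ _) (zeroʳ _)) (*-congʳ f-1)) (trans (*-identityʳ _) f-2))
    (solve 1 (λ a → (con (ℤ.+ 0) :+ a :* (:- a) :+ a :* a) := con (ℤ.+ 0)) refl a)
    where open Solver
  f*w≈1 (suc (suc (suc m))) = begin
    sumTo R (suc m) h + h (suc m) + h (2 N.+ m) + h (3 N.+ m)       ≈⟨ +-cong (+-cong (+-cong front (at 2 (suc m) P.refl)) (at 1 (2 N.+ m) P.refl)) (at 0 (3 N.+ m) P.refl) ⟩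
    - (b * mulS R f f m) + f (suc m) * 0# + f (2 N.+ m) * (- a) + f (3 N.+ m) * 1# ≈⟨ +-congˡ (trans (*-identityʳ _) (f-+3 m)) ⟩
    - (b * mulS R f f m) + f (suc m) * 0# + f (2 N.+ m) * (- a) + (a * f (2 N.+ m) + b * mulS R f f m)
      ≈⟨ solve 5 (λ a b x y z → (:- (b :* x) :+ y :* con (ℤ.+ 0) :+ z :* (:- a) :+ (a :* z :+ b :* x)) := con (ℤ.+ 0)) refl
               a b (mulS R f f m) (f (suc m)) (f (2 N.+ m)) ⟩
    0#                                                              ∎
    where
    open Solver
    h : ℕ → Carrier
    h l = f l * w (3 N.+ m N.∸ l)
    at : ∀ e k → e N.+ k ≡ 3 N.+ m → h k ≈ f k * w e
    at e k e+k≡ = *-congˡ (reflexive (P.cong w (P.trans (P.cong (N._∸ k) (P.sym e+k≡)) (NP.m+n∸n≡m e k))))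
    -- the first m+1 terms see w (3 + (m - l)) = - b f (m - l): together - b (f²)_m
    front : sumTo R (suc m) h ≈ - (b * mulS R f f m)
    front = begin
      sumTo R (suc m) h
        ≈⟨ sum-cong (suc m) (λ l l< → trans (reflexive (P.cong (λ u → f l * w u) (NP.+-∸-assoc 3 (NP.≤-pred l<)))) (*-congˡ (-‿cong (*-comm _ _)))) ⟩
      sumTo R (suc m) (λ l → f l * - (f (m N.∸ l) * b))
        ≈⟨ sum-cong′ (suc m) (λ l → trans (sym (-‿distribʳ-* _ _)) (-‿cong (sym (*-assoc _ _ _)))) ⟩
      sumTo R (suc m) (λ l → - ((f l * f (m N.∸ l)) * b))  ≈⟨ sum-neg (suc m) _ ⟩
      - sumTo R (suc m) (λ l → (f l * f (m N.∸ l)) * b)    ≈⟨ -‿cong (trans (sum-*ʳ (suc m) b _) (*-comm _ _)) ⟩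
      - (b * mulS R f f m)                                  ∎

  w*f≈1 : ∀ i → sumTo R (suc i) (λ k → f (i N.∸ k) * w k) ≈ δ i
  w*f≈1 i = trans (sum-cong (suc i) (λ k k< → reflexive (P.cong (λ u → f (i N.∸ k) * w u) (P.sym (NP.m∸[m∸n]≡n (NP.≤-pred k<))))))
                  (trans (sym (sum-rev (suc i) (λ l → f l * w (i N.∸ l)))) (f*w≈1 i))

  shifted-f*w : ∀ s j → sumTo R (suc j) (λ l → f (s N.+ l) * w (j N.∸ l))
                        ≈ δ (s N.+ j) - sumTo R s (λ m → f m * w (s N.+ j N.∸ m))
  shifted-f*w s j = begin
    tail                    ≈⟨ sym (+-identityˡ _) ⟩
    0# + tail               ≈⟨ +-congʳ (sym (-‿inverseˡ head)) ⟩
    (- head + head) + tail  ≈⟨ +-assoc _ _ _ ⟩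
    - head + (head + tail)  ≈⟨ +-congˡ (sym whole) ⟩
    - head + mulS R f w (s N.+ j) ≈⟨ +-congˡ (f*w≈1 (s N.+ j)) ⟩
    - head + δ (s N.+ j)    ≈⟨ +-comm _ _ ⟩
    δ (s N.+ j) - head      ∎
    where
    g : ℕ → Carrier
    g m = f m * w (s N.+ j N.∸ m)
    head = sumTo R s g
    tail = sumTo R (suc j) (λ l → f (s N.+ l) * w (j N.∸ l))
    whole : mulS R f w (s N.+ j) ≈ head + tail
    whole = begin
      sumTo R (suc (s N.+ j)) g                     ≡⟨ P.cong (λ u → sumTo R u g) (P.sym (NP.+-suc s j)) ⟩
      sumTo R (s N.+ suc j) g                       ≈⟨ sum-split s (suc j) g ⟩
      head + sumTo R (suc j) (λ l → g (s N.+ l))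
        ≈⟨ +-congˡ (sum-cong′ (suc j) (λ l → reflexive (P.cong (λ u → f (s N.+ l) * w u) (NP.[m+n]∸[m+o]≡n∸o s j l)))) ⟩
      head + tail                                   ∎

  -- the rank-one matrix e₀ e₀ᵀ, as a Hankel matrix
  δ-+ : ∀ k j → δ (k N.+ j) ≈ δ k * δ j
  δ-+ zero    zero    = sym (*-identityʳ _)
  δ-+ zero    (suc j) = sym (zeroʳ _)
  δ-+ (suc k) j       = sym (zeroˡ _)

  sum-δ : ∀ i (g : ℕ → Carrier) → sumTo R (suc i) (λ k → g k * δ k) ≈ g 0
  sum-δ i g = trans (sum-single (suc i) 0 (s≤s z≤n) vanish) (*-identityʳ _)
    where
    vanish : ∀ k → k N.< suc i → k ≢ 0 → g k * δ k ≈ 0#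
    vanish zero    _ 0≢0 = ⊥-elim (0≢0 P.refl)
    vanish (suc k) _ _   = zeroʳ _

  -- z² f, whose Hankel matrix appears after the first column operation
  c₂ : Series R
  c₂ = zS R (zS R f)

  -w-suc : ∀ n → - w (suc n) ≈ a * δ n + b * c₂ n
  -w-suc zero          = solve 2 (λ a b → (:- (:- a)) := (a :* con (ℤ.+ 1) :+ b :* con (ℤ.+ 0))) refl a b
    where open Solver
  -w-suc (suc zero)    = solve 2 (λ a b → (:- con (ℤ.+ 0)) := (a :* con (ℤ.+ 0) :+ b :* con (ℤ.+ 0))) refl a b
    where open Solver
  -w-suc (suc (suc m)) = solve 3 (λ a b x → (:- (:- (b :* x))) := (a :* con (ℤ.+ 0) :+ b :* x)) refl a b (f m)
    where open Solver

  A : Carrier → Mat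
  A t i j = f (i N.+ j N.+ 1) + t * f i * f j

  -- after the first column operation: (a+t) e₀ e₀ᵀ + b (z² f) (k+j)
  X : Carrier → Mat
  X t k j = (a + t) * (δ k * δ j) + b * c₂ (k N.+ j)

  stage₁ : ∀ t i j → mulU (A t) (toeplitzᵀ w) i j ≈ mulL (toeplitz f) (X t) i j
  stage₁ t i j = begin
    mulU (A t) (toeplitzᵀ w) i j ≈⟨ mulU-toeplitzᵀ (A t) w i j ⟩
    sumTo R (suc j) (λ l → A t i l * w (j N.∸ l))
      ≈⟨ sum-cong′ (suc j) (λ l → trans (distribʳ _ _ _) (+-cong (*-congʳ (reflexive (P.cong f (NP.+-comm (i N.+ l) 1)))) (trans (*-assoc _ _ _) (*-assoc _ _ _)))) ⟩
    sumTo R (suc j) (λ l → f (suc i N.+ l) * w (j N.∸ l) + t * (f i * (f l * w (j N.∸ l)))) ≈⟨ sum-+ (suc j) _ _ ⟩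
    sumTo R (suc j) (λ l → f (suc i N.+ l) * w (j N.∸ l)) + sumTo R (suc j) (λ l → t * (f i * (f l * w (j N.∸ l))))
      ≈⟨ +-cong (shifted-f*w (suc i) j) (trans (sum-*ˡ (suc j) t _) (*-congˡ (trans (sum-*ˡ (suc j) (f i) _) (*-congˡ (f*w≈1 j))))) ⟩
    (0# - sumTo R (suc i) (λ m → f m * w (suc i N.+ j N.∸ m))) + t * (f i * δ j) ≈⟨ +-congʳ (+-identityˡ _) ⟩
    - sumTo R (suc i) (λ m → f m * w (suc i N.+ j N.∸ m)) + t * (f i * δ j)     ≈⟨ +-congʳ (-‿cong (sum-rev (suc i) _)) ⟩
    - sumTo R (suc i) (λ k → f (i N.∸ k) * w (suc i N.+ j N.∸ (i N.∸ k))) + t * (f i * δ j)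
      ≈⟨ +-congʳ (-‿cong (sum-cong (suc i) (λ k k< → *-congˡ (reflexive (P.cong w (reversed-index i k j (NP.≤-pred k<))))))) ⟩
    - sumTo R (suc i) (λ k → f (i N.∸ k) * w (suc (k N.+ j))) + t * (f i * δ j)
      ≈⟨ +-congʳ (trans (sym (sum-neg (suc i) _)) (sum-cong′ (suc i) (λ k → trans (-‿distribʳ-* _ _) (*-congˡ (trans (-w-suc (k N.+ j)) (+-congʳ (*-congˡ (δ-+ k j)))))))) ⟩
    sumTo R (suc i) (λ k → f (i N.∸ k) * (a * (δ k * δ j) + b * c₂ (k N.+ j))) + t * (f i * δ j) ≈⟨ +-congˡ (sym tPart) ⟩
    sumTo R (suc i) (λ k → f (i N.∸ k) * (a * (δ k * δ j) + b * c₂ (k N.+ j))) + sumTo R (suc i) (λ k → f (i N.∸ k) * (t * (δ k * δ j)))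
      ≈⟨ sym (sum-+ (suc i) _ _) ⟩
    sumTo R (suc i) (λ k → f (i N.∸ k) * (a * (δ k * δ j) + b * c₂ (k N.+ j)) + f (i N.∸ k) * (t * (δ k * δ j)))
      ≈⟨ sum-cong′ (suc i) (λ k → collect (f (i N.∸ k)) a t (δ k * δ j) (b * c₂ (k N.+ j))) ⟩
    sumTo R (suc i) (λ k → f (i N.∸ k) * X t k j) ≈⟨ sym (mulL-toeplitz f (X t) i j) ⟩
    mulL (toeplitz f) (X t) i j ∎
    where
    open Solver
    collect : ∀ x a t d e → x * (a * d + e) + x * (t * d) ≈ x * ((a + t) * d + e)
    collect = solve 5 (λ x a t d e → (x :* (a :* d :+ e) :+ x :* (t :* d)) := (x :* ((a :+ t) :* d :+ e))) refl
    tPart : sumTo R (suc i) (λ k → f (i N.∸ k) * (t * (δ k * δ j))) ≈ t * (f i * δ j)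
    tPart = begin
      sumTo R (suc i) (λ k → f (i N.∸ k) * (t * (δ k * δ j)))
        ≈⟨ sum-cong′ (suc i) (λ k → solve 4 (λ x t d e → (x :* (t :* (d :* e))) := ((x :* t :* e) :* d)) refl (f (i N.∸ k)) t (δ k) (δ j)) ⟩
      sumTo R (suc i) (λ k → (f (i N.∸ k) * t * δ j) * δ k) ≈⟨ sum-δ i (λ k → f (i N.∸ k) * t * δ j) ⟩
      f i * t * δ j ≈⟨ solve 3 (λ x t d → (x :* t :* d) := (t :* (x :* d))) refl (f i) t (δ j) ⟩
      t * (f i * δ j) ∎

  -- Q = T(w) H(z² f) Tᵀ(w), with H the Hankel matrix: the 3 × 3 corner is
  -- (w (k+j-2)) for k+j ≥ 2, and from row and column 3 on the entries are b f(k+l+1).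
  Q : Mat
  Q 0 2 = 1#
  Q 1 1 = 1#
  Q 1 2 = - a
  Q 2 0 = 1#
  Q 2 1 = - a
  Q (suc (suc (suc k))) (suc (suc (suc l))) = b * f (k N.+ l N.+ 1)
  Q _ _ = 0#

  -- after the second column operation
  M : Carrier → Mat
  M t i j = (a + t) * (w i * w j) + b * Q i j

  private
    splitRows : ∀ i′ j → sumTo R (3 N.+ i′) (λ k → f (2 N.+ i′ N.∸ k) * Q k j)
                       ≈ sumTo R 3 (λ k → f (2 N.+ i′ N.∸ k) * Q k j) + sumTo R i′ (λ k → f (i′ N.∸ suc k) * Q (3 N.+ k) j)
    splitRows i′ j = sum-split 3 i′ _

    firstRows : ∀ i′ j → (∀ k → Q (3 N.+ k) j ≈ 0#)
              → sumTo R (3 N.+ i′) (λ k → f (2 N.+ i′ N.∸ k) * Q k j) ≈ sumTo R 3 (λ k → f (2 N.+ i′ N.∸ k) * Q k j)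
    firstRows i′ j vanish = trans (splitRows i′ j)
      (trans (+-congˡ (sum-zero i′ (λ k _ → trans (*-congˡ (vanish k)) (zeroʳ _)))) (+-identityʳ _))

    f-+ : ∀ i′ d → f (i′ N.+ d) ≈ f (d N.+ i′)
    f-+ i′ d = reflexive (P.cong f (NP.+-comm i′ d))

  -- The core of the second column operation: H(z² f) Tᵀ(w) = T(f) Q,
  -- checked column by column (columns 0, 1, 2 by direct computation).
  hankel-c₂ : ∀ i j → sumTo R (suc j) (λ l → c₂ (i N.+ l) * w (j N.∸ l)) ≈ sumTo R (suc i) (λ k → f (i N.∸ k) * Q k j)
  hankel-c₂ 0 0 = solve 1 (λ x → (con (ℤ.+ 0) :+ con (ℤ.+ 0) :* con (ℤ.+ 1)) := (con (ℤ.+ 0) :+ x :* con (ℤ.+ 0))) refl (f 0)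
    where open Solver
  hankel-c₂ 1 0 = solve 2 (λ x y → (con (ℤ.+ 0) :+ con (ℤ.+ 0) :* con (ℤ.+ 1)) := ((con (ℤ.+ 0) :+ x :* con (ℤ.+ 0)) :+ y :* con (ℤ.+ 0))) refl (f 1) (f 0)
    where open Solver
  hankel-c₂ (suc (suc i′)) 0 = trans (+-congˡ (*-congʳ (f-+ i′ 0)))
    (trans (solve 3 (λ x y z → (con (ℤ.+ 0) :+ z :* con (ℤ.+ 1)) := (((con (ℤ.+ 0) :+ x :* con (ℤ.+ 0)) :+ y :* con (ℤ.+ 0)) :+ z :* con (ℤ.+ 1))) refl
                  (f (2 N.+ i′)) (f (suc i′)) (f i′))
           (sym (firstRows i′ 0 (λ _ → refl))))
    where open Solver
  hankel-c₂ 0 1 = solve 2 (λ a x → ((con (ℤ.+ 0) :+ con (ℤ.+ 0) :* (:- a)) :+ con (ℤ.+ 0) :* con (ℤ.+ 1)) := (con (ℤ.+ 0) :+ x :* con (ℤ.+ 0))) refl a (f 0)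
    where open Solver
  hankel-c₂ 1 1 = solve 3 (λ a x y → ((con (ℤ.+ 0) :+ con (ℤ.+ 0) :* (:- a)) :+ y :* con (ℤ.+ 1)) := ((con (ℤ.+ 0) :+ x :* con (ℤ.+ 0)) :+ y :* con (ℤ.+ 1))) refl a (f 1) (f 0)
    where open Solver
  hankel-c₂ (suc (suc i′)) 1 = trans (+-cong (+-congˡ (*-congʳ (f-+ i′ 0))) (*-congʳ (f-+ i′ 1)))
    (trans (solve 4 (λ a x y z → ((con (ℤ.+ 0) :+ z :* (:- a)) :+ y :* con (ℤ.+ 1)) := (((con (ℤ.+ 0) :+ x :* con (ℤ.+ 0)) :+ y :* con (ℤ.+ 1)) :+ z :* (:- a))) refl
                  a (f (2 N.+ i′)) (f (suc i′)) (f i′))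
           (sym (firstRows i′ 1 (λ _ → refl))))
    where open Solver
  hankel-c₂ 0 2 = solve 2 (λ a x → (((con (ℤ.+ 0) :+ con (ℤ.+ 0) :* con (ℤ.+ 0)) :+ con (ℤ.+ 0) :* (:- a)) :+ x :* con (ℤ.+ 1)) := (con (ℤ.+ 0) :+ x :* con (ℤ.+ 1))) refl a (f 0)
    where open Solver
  hankel-c₂ 1 2 = solve 3 (λ a x y → (((con (ℤ.+ 0) :+ con (ℤ.+ 0) :* con (ℤ.+ 0)) :+ y :* (:- a)) :+ x :* con (ℤ.+ 1)) := ((con (ℤ.+ 0) :+ x :* con (ℤ.+ 1)) :+ y :* (:- a))) refl a (f 1) (f 0)
    where open Solver
  hankel-c₂ (suc (suc i′)) 2 = trans (+-cong (+-cong (+-congˡ (*-congʳ (f-+ i′ 0))) (*-congʳ (f-+ i′ 1))) (*-congʳ (f-+ i′ 2)))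
    (trans (solve 4 (λ a x y z → (((con (ℤ.+ 0) :+ z :* con (ℤ.+ 0)) :+ y :* (:- a)) :+ x :* con (ℤ.+ 1)) := (((con (ℤ.+ 0) :+ x :* con (ℤ.+ 1)) :+ y :* (:- a)) :+ z :* con (ℤ.+ 0))) refl
                  a (f (2 N.+ i′)) (f (suc i′)) (f i′))
           (sym (firstRows i′ 2 (λ _ → refl))))
    where open Solver
  hankel-c₂ 0 (suc (suc (suc n))) = begin
    sumTo R (4 N.+ n) (λ l → c₂ l * w (3 N.+ n N.∸ l))                              ≈⟨ sum-front (3 N.+ n) _ ⟩
    0# * w (3 N.+ n) + sumTo R (3 N.+ n) (λ l → c₂ (suc l) * w (2 N.+ n N.∸ l))     ≈⟨ +-cong (zeroˡ _) (sum-front (2 N.+ n) _) ⟩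
    0# + (0# * w (2 N.+ n) + mulS R f w (suc n))                                    ≈⟨ trans (+-identityˡ _) (+-cong (zeroˡ _) (f*w≈1 (suc n))) ⟩
    0# + 0#                                                                          ≈⟨ +-congˡ (sym (zeroʳ _)) ⟩
    0# + f 0 * 0#                                                                    ∎
  hankel-c₂ 1 (suc (suc (suc n))) = begin
    sumTo R (4 N.+ n) (λ l → c₂ (suc l) * w (3 N.+ n N.∸ l))   ≈⟨ sum-front (3 N.+ n) _ ⟩
    0# * w (3 N.+ n) + mulS R f w (2 N.+ n)                    ≈⟨ +-cong (zeroˡ _) (f*w≈1 (2 N.+ n)) ⟩
    0# + 0#                                                    ≈⟨ sym (trans (+-cong (+-congˡ (zeroʳ _)) (zeroʳ _)) (+-congʳ (+-identityˡ _))) ⟩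
    (0# + f 1 * 0#) + f 0 * 0#                                 ∎
  hankel-c₂ (suc (suc i′)) (suc (suc (suc n))) = begin
    sumTo R (suc j) (λ l → f (i′ N.+ l) * w (j N.∸ l))                  ≈⟨ shifted-f*w i′ j ⟩
    δ (i′ N.+ j) - sumTo R i′ (λ m → f m * w (i′ N.+ j N.∸ m))
      ≈⟨ +-cong (reflexive (P.cong δ (NP.+-suc i′ (2 N.+ n)))) (-‿cong (sum-cong i′ (λ m m< → *-congˡ (reflexive (P.cong w (index m (NP.<⇒≤ m<))))))) ⟩
    0# - sumTo R i′ (λ m → f m * - (b * f (i′ N.+ n N.∸ m)))           ≈⟨ trans (+-identityˡ _) (-‿cong (sum-cong′ i′ (λ m → sym (-‿distribʳ-* _ _)))) ⟩
    - sumTo R i′ (λ m → - (f m * (b * f (i′ N.+ n N.∸ m))))           ≈⟨ trans (-‿cong (sum-neg i′ _)) (-‿involutive _) ⟩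
    sumTo R i′ (λ m → f m * (b * f (i′ N.+ n N.∸ m)))                 ≈⟨ reverse i′ ⟩
    sumTo R i′ (λ k → f (i′ N.∸ suc k) * Q (3 N.+ k) j)               ≈⟨ sym (+-identityˡ _) ⟩
    0# + sumTo R i′ (λ k → f (i′ N.∸ suc k) * Q (3 N.+ k) j)
      ≈⟨ +-congʳ (sym (trans (+-cong (+-cong (+-congˡ (zeroʳ _)) (zeroʳ _)) (zeroʳ _)) (trans (+-identityʳ _) (trans (+-identityʳ _) (+-identityʳ _))))) ⟩
    sumTo R 3 (λ k → f (2 N.+ i′ N.∸ k) * Q k j) + sumTo R i′ (λ k → f (i′ N.∸ suc k) * Q (3 N.+ k) j) ≈⟨ sym (splitRows i′ j) ⟩
    sumTo R (3 N.+ i′) (λ k → f (2 N.+ i′ N.∸ k) * Q k j)             ∎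
    where
    j = 3 N.+ n
    index : ∀ m → m N.≤ i′ → i′ N.+ j N.∸ m ≡ 3 N.+ (i′ N.+ n N.∸ m)
    index m m≤i′ = P.trans (P.cong (N._∸ m) (P.trans (NP.+-comm i′ j) (P.cong (3 N.+_) (NP.+-comm n i′))))
                           (NP.+-∸-assoc 3 (NP.≤-trans m≤i′ (NP.m≤m+n i′ n)))
    reverse : ∀ i′ → sumTo R i′ (λ m → f m * (b * f (i′ N.+ n N.∸ m))) ≈ sumTo R i′ (λ k → f (i′ N.∸ suc k) * Q (3 N.+ k) j)
    reverse zero      = refl
    reverse (suc i″) = trans (sum-rev (suc i″) _)
      (sum-cong (suc i″) (λ k k< → *-congˡ (*-congˡ (reflexive (P.cong f (P.trans (reversed-index i″ k n (NP.≤-pred k<)) (NP.+-comm 1 (k N.+ n))))))))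

  stage₂ : ∀ t i j → mulU (X t) (toeplitzᵀ w) i j ≈ mulL (toeplitz f) (M t) i j
  stage₂ t i j = begin
    mulU (X t) (toeplitzᵀ w) i j                                ≈⟨ mulU-toeplitzᵀ (X t) w i j ⟩
    sumTo R (suc j) (λ l → X t i l * w (j N.∸ l))
      ≈⟨ sum-cong′ (suc j) (λ l → trans (distribʳ _ _ _) (+-cong (moveδ (a + t) (δ i) (δ l) (w (j N.∸ l))) (*-assoc _ _ _))) ⟩
    sumTo R (suc j) (λ l → ((a + t) * δ i * w (j N.∸ l)) * δ l + b * (c₂ (i N.+ l) * w (j N.∸ l))) ≈⟨ sum-+ (suc j) _ _ ⟩
    sumTo R (suc j) (λ l → ((a + t) * δ i * w (j N.∸ l)) * δ l) + sumTo R (suc j) (λ l → b * (c₂ (i N.+ l) * w (j N.∸ l)))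
      ≈⟨ +-cong (sum-δ j (λ l → (a + t) * δ i * w (j N.∸ l))) (trans (sum-*ˡ (suc j) b _) (*-congˡ (hankel-c₂ i j))) ⟩
    (a + t) * δ i * w j + b * sumTo R (suc i) (λ k → f (i N.∸ k) * Q k j)
      ≈⟨ +-congʳ (trans (*-assoc _ _ _) (*-congˡ (sym (trans (sum-*ʳ (suc i) (w j) _) (*-congʳ (w*f≈1 i)))))) ⟩
    (a + t) * sumTo R (suc i) (λ k → f (i N.∸ k) * w k * w j) + b * sumTo R (suc i) (λ k → f (i N.∸ k) * Q k j)
      ≈⟨ sym (trans (sum-+ (suc i) _ _) (+-cong (sum-*ˡ (suc i) _ _) (sum-*ˡ (suc i) _ _))) ⟩
    sumTo R (suc i) (λ k → (a + t) * (f (i N.∸ k) * w k * w j) + b * (f (i N.∸ k) * Q k j))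
      ≈⟨ sum-cong′ (suc i) (λ k → collect (a + t) b (f (i N.∸ k)) (w k) (w j) (Q k j)) ⟩
    sumTo R (suc i) (λ k → f (i N.∸ k) * M t k j)               ≈⟨ sym (mulL-toeplitz f (M t) i j) ⟩
    mulL (toeplitz f) (M t) i j                                 ∎
    where
    open Solver
    moveδ : ∀ s x y v → (s * (x * y)) * v ≈ (s * x * v) * y
    moveδ = solve 4 (λ s x y v → ((s :* (x :* y)) :* v) := ((s :* x :* v) :* y)) refl
    collect : ∀ s b x u v q → s * (x * u * v) + b * (x * q) ≈ x * (s * (u * v) + b * q)
    collect = solve 6 (λ s b x u v q → (s :* (x :* u :* v) :+ b :* (x :* q)) := (x :* (s :* (u :* v) :+ b :* q))) refl

module HankelRecursion {c ℓ} (R : CommutativeRing c ℓ) (a b : CommutativeRing.Carrier R)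
                       (f : Series R) (isF : IsF3 R a b f) where
  open Basics R
  open Determinants R
  open Triangular R
  open SeriesF3 R a b f isF

  identity : Mat
  identity zero    zero    = 1#
  identity zero    (suc j) = 0#
  identity (suc l) zero    = 0#
  identity (suc l) (suc j) = identity l j

  identity-≡ : ∀ j → identity j j ≈ 1#
  identity-≡ zero    = refl
  identity-≡ (suc j) = identity-≡ j

  identity-≢ : ∀ l j → l ≢ j → identity l j ≈ 0#
  identity-≢ zero    zero    l≢j = ⊥-elim (l≢j P.refl)
  identity-≢ zero    (suc j) _   = refl
  identity-≢ (suc l) zero    _   = refl
  identity-≢ (suc l) (suc j) l≢j = identity-≢ l j (λ e → l≢j (P.cong suc e))

  identity-lowerUni : LowerUni identity
  identity-lowerUni = identity-≡ , (λ i k i<k → identity-≢ i k (NP.<⇒≢ i<k))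

  mulL-identity : ∀ (Z : Mat) i j → mulL identity Z i j ≈ Z i j
  mulL-identity Z i j = trans (sum-single (suc i) i NP.≤-refl (λ k _ k≢i → trans (*-congʳ (identity-≢ i k (λ e → k≢i (P.sym e)))) (zeroˡ _)))
                              (trans (*-congʳ (identity-≡ i)) (*-identityˡ _))

  -- Third column operation: add (a+t) f n times column 2 to column 3+n.
  -- The matrix is E_t = 1 + (a+t) e₂ (0,0,0,f 0,f 1,...).
  extra : Carrier → ℕ → ℕ → Carrier
  extra t (suc (suc (suc n))) 2 = (a + t) * f n
  extra t _ _ = 0#

  E : Carrier → Mat
  E t l j = identity l j + extra t j l

  E-diag : ∀ t j → E t j j ≈ 1#
  E-diag t 0                   = +-identityʳ _
  E-diag t 1                   = +-identityʳ _
  E-diag t 2                   = +-identityʳ _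
  E-diag t (suc (suc (suc n))) = trans (+-identityʳ _) (identity-≡ n)

  mulU-E : ∀ (Z : Mat) t i j → mulU Z (E t) i j ≈ Z i j + sumTo R (suc j) (λ l → Z i l * extra t j l)
  mulU-E Z t i j = trans (sum-cong′ (suc j) (λ l → distribˡ _ _ _)) (trans (sum-+ (suc j) _ _) (+-congʳ unit))
    where
    unit : sumTo R (suc j) (λ l → Z i l * identity l j) ≈ Z i j
    unit = trans (sum-single (suc j) j NP.≤-refl (λ l _ l≢j → trans (*-congˡ (identity-≢ l j l≢j)) (zeroʳ _)))
                 (trans (*-congˡ (identity-≡ j)) (*-identityʳ _))

  Y : Carrier → Mat
  Y t = mulU (M t) (E t)

  Y-first : ∀ t i j → j N.< 3 → Y t i j ≈ M t i j
  Y-first t i 0 _ = trans (mulU-E (M t) t i 0) (trans (+-congˡ (trans (+-identityˡ _) (zeroʳ _))) (+-identityʳ _))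
  Y-first t i 1 _ = trans (mulU-E (M t) t i 1) (trans (+-congˡ (sum-zero 2 {λ l → M t i l * extra t 1 l} (λ _ _ → zeroʳ _))) (+-identityʳ _))
  Y-first t i 2 _ = trans (mulU-E (M t) t i 2) (trans (+-congˡ (sum-zero 3 {λ l → M t i l * extra t 2 l} (λ _ _ → zeroʳ _))) (+-identityʳ _))
  Y-first t i (suc (suc (suc j))) (s≤s (s≤s (s≤s ())))

  Y-later : ∀ t i n → Y t i (3 N.+ n) ≈ M t i (3 N.+ n) + M t i 2 * ((a + t) * f n)
  Y-later t i n = trans (mulU-E (M t) t i (3 N.+ n))
    (+-congˡ (sum-single (4 N.+ n) 2 (s≤s (s≤s (s≤s z≤n))) (λ l _ l≢2 → trans (*-congˡ (onlyAt2 l l≢2)) (zeroʳ _))))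
    where
    onlyAt2 : ∀ l → l ≢ 2 → extra t (3 N.+ n) l ≈ 0#
    onlyAt2 0                   _   = refl
    onlyAt2 1                   _   = refl
    onlyAt2 2                   2≢2 = ⊥-elim (2≢2 P.refl)
    onlyAt2 (suc (suc (suc l))) _   = refl

  Y-upperZero : ∀ t i j → i N.< 3 → 3 N.≤ j → Y t i j ≈ 0#
  Y-upperZero t i (suc (suc (suc n))) i<3 _ = trans (Y-later t i n) (rows i i<3)
    where
    open Solver
    rows : ∀ i → i N.< 3 → M t i (3 N.+ n) + M t i 2 * ((a + t) * f n) ≈ 0#
    rows 0 _ = solve 4 (λ a t b x → ((a :+ t) :* (con (ℤ.+ 1) :* (:- (b :* x))) :+ b :* con (ℤ.+ 0) :+ ((a :+ t) :* (con (ℤ.+ 1) :* con (ℤ.+ 0)) :+ b :* con (ℤ.+ 1)) :* ((a :+ t) :* x)) := con (ℤ.+ 0)) refl a t b (f n)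
    rows 1 _ = solve 4 (λ a t b x → ((a :+ t) :* ((:- a) :* (:- (b :* x))) :+ b :* con (ℤ.+ 0) :+ ((a :+ t) :* ((:- a) :* con (ℤ.+ 0)) :+ b :* (:- a)) :* ((a :+ t) :* x)) := con (ℤ.+ 0)) refl a t b (f n)
    rows 2 _ = solve 4 (λ a t b x → ((a :+ t) :* (con (ℤ.+ 0) :* (:- (b :* x))) :+ b :* con (ℤ.+ 0) :+ ((a :+ t) :* (con (ℤ.+ 0) :* con (ℤ.+ 0)) :+ b :* con (ℤ.+ 0)) :* ((a :+ t) :* x)) := con (ℤ.+ 0)) refl a t b (f n)
    rows (suc (suc (suc _))) (s≤s (s≤s (s≤s ())))
  Y-upperZero t 0 (suc (suc zero)) _ (s≤s (s≤s ()))
  Y-upperZero t 1 (suc (suc zero)) _ (s≤s (s≤s ()))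
  Y-upperZero t i 0 _ ()
  Y-upperZero t i 1 _ (s≤s ())

  Y-corner : ∀ t → det′ 3 (Y t) ≈ - (b * b * b)
  Y-corner t = trans (det′-cong 3 (λ i j _ j<3 → Y-first t i j j<3)) (trans (det₃ (M t)) expand)
    where
    open Solver
    expand = solve 3 (λ a t b →
      let entry = λ wi wj q → (a :+ t) :* (wi :* wj) :+ b :* q
          o = con (ℤ.+ 0)
          i = con (ℤ.+ 1)
          m00 = entry i i o ; m01 = entry i (:- a) o ; m02 = entry i o i
          m10 = entry (:- a) i o ; m11 = entry (:- a) (:- a) i ; m12 = entry (:- a) o (:- a)
          m20 = entry o i i ; m21 = entry o (:- a) (:- a) ; m22 = entry o o o
      in (m00 :* (m11 :* m22 :- m12 :* m21) :- m01 :* (m10 :* m22 :- m12 :* m20) :+ m02 :* (m10 :* m21 :- m11 :* m20))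
         := (:- (b :* b :* b))) refl a t b

  Y-shift : ∀ t i j → shift 3 (Y t) i j ≈ (b * b) * A (t + a) i j
  Y-shift t i j = trans (Y-later t (3 N.+ i) j)
    (solve 6 (λ a t b x y z → ((a :+ t) :* ((:- (b :* x)) :* (:- (b :* y))) :+ b :* (b :* z)
                               :+ ((a :+ t) :* ((:- (b :* x)) :* con (ℤ.+ 0)) :+ b :* con (ℤ.+ 0)) :* ((a :+ t) :* y))
                              := ((b :* b) :* (z :+ (t :+ a) :* x :* y))) refl a t b (f i) (f j) (f (i N.+ j N.+ 1)))
    where open Solver

  -- a column operation Z ↦ Z·V (V upper unitriangular) with Z·V = T·Z′ lets a
  -- lower triangular factor T move from the matrix into the left factor
  det-transfer : ∀ n L T Z Z′ V → (∀ j → V j j ≈ 1#) → (∀ i k → i N.< k → T i k ≈ 0#)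
               → (∀ i j → mulU Z V i j ≈ mulL T Z′ i j)
               → det′ n (mulL L Z) ≈ det′ n (mulL (mulL L T) Z′)
  det-transfer n L T Z Z′ V Vdiag T-lower ZV≈TZ′ = begin
    det′ n (mulL L Z)           ≈⟨ sym (det-mulU n (mulL L Z) V Vdiag) ⟩
    det′ n (mulU (mulL L Z) V)  ≈⟨ det′-cong′ n (λ i j → trans (mulL-mulU L Z V i j) (mulL-cong L ZV≈TZ′ i j)) ⟩
    det′ n (mulL L (mulL T Z′)) ≈⟨ det′-cong′ n (mulL-mulL L T Z′ T-lower) ⟩
    det′ n (mulL (mulL L T) Z′) ∎

  toeplitz-f : LowerUni (toeplitz f)
  toeplitz-f = toeplitz-lowerUni f f-0

  toeplitzᵀ-w-diag : ∀ j → toeplitzᵀ w j j ≈ 1#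
  toeplitzᵀ-w-diag j = trans (toeplitz-≤ w j j NP.≤-refl) (reflexive (P.cong w (NP.n∸n≡0 j)))

  blockFactor : Mat → Mat
  blockFactor L = mulL (mulL L (toeplitz f)) (toeplitz f)

  blockFactor-uni : ∀ L → LowerUni L → LowerUni (blockFactor L)
  blockFactor-uni L L-uni = LowerUni-mul _ (toeplitz f) (LowerUni-mul L (toeplitz f) L-uni toeplitz-f) toeplitz-f

  to-block-form : ∀ n t L → det′ n (mulL L (A t)) ≈ det′ n (mulL (blockFactor L) (Y t))
  to-block-form n t L = begin
    det′ n (mulL L (A t))              ≈⟨ det-transfer n L (toeplitz f) (A t) (X t) (toeplitzᵀ w) toeplitzᵀ-w-diag (proj₂ toeplitz-f) (stage₁ t) ⟩
    det′ n (mulL L₁ (X t))             ≈⟨ det-transfer n L₁ (toeplitz f) (X t) (M t) (toeplitzᵀ w) toeplitzᵀ-w-diag (proj₂ toeplitz-f) (stage₂ t) ⟩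
    det′ n (mulL L₂ (M t))             ≈⟨ sym (det-mulU n (mulL L₂ (M t)) (E t) (E-diag t)) ⟩
    det′ n (mulU (mulL L₂ (M t)) (E t)) ≈⟨ det′-cong′ n (mulL-mulU L₂ (M t) (E t)) ⟩
    det′ n (mulL L₂ (Y t))             ∎
    where
    L₁ L₂ : Mat
    L₁ = mulL L (toeplitz f)
    L₂ = blockFactor L

  nextFactor : Mat → Mat
  nextFactor L = shift 3 (blockFactor L)

  reduction : ∀ m t L → LowerUni L
            → det′ (3 N.+ m) (mulL L (A t)) ≈ - (b * b * b) * (pow R (b * b) m * det′ m (mulL (nextFactor L) (A (t + a))))
  reduction m t L L-uni = begin
    det′ (3 N.+ m) (mulL L (A t))                                ≈⟨ to-block-form (3 N.+ m) t L ⟩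
    det′ (3 N.+ m) (mulL L₂ (Y t))                               ≈⟨ det-block 3 m (mulL L₂ (Y t)) (mulL-upperZero 3 L₂ (Y t) (Y-upperZero t)) ⟩
    det′ 3 (mulL L₂ (Y t)) * det′ m (shift 3 (mulL L₂ (Y t)))    ≈⟨ *-cong (trans (det₃-mulL L₂ (Y t) (blockFactor-uni L L-uni)) (Y-corner t)) lowerBlock ⟩
    - (b * b * b) * (pow R (b * b) m * det′ m (mulL L₃ (A (t + a)))) ∎
    where
    L₂ L₃ : Mat
    L₂ = blockFactor L
    L₃ = nextFactor L
    pullScalar : ∀ i j → mulL L₃ (λ i j → (b * b) * A (t + a) i j) i j ≈ (b * b) * mulL L₃ (A (t + a)) i j
    pullScalar i j = trans (sum-cong′ (suc i) (λ k → trans (sym (*-assoc _ _ _)) (trans (*-congʳ (*-comm _ _)) (*-assoc _ _ _))))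
                           (sum-*ˡ (suc i) (b * b) _)
    lowerBlock : det′ m (shift 3 (mulL L₂ (Y t))) ≈ pow R (b * b) m * det′ m (mulL L₃ (A (t + a)))
    lowerBlock = begin
      det′ m (shift 3 (mulL L₂ (Y t)))                    ≈⟨ det′-cong′ m (mulL-shift 3 L₂ (Y t) (Y-upperZero t)) ⟩
      det′ m (mulL L₃ (shift 3 (Y t)))                    ≈⟨ det′-cong′ m (λ i j → trans (mulL-cong L₃ (Y-shift t) i j) (pullScalar i j)) ⟩
      det′ m (λ i j → (b * b) * mulL L₃ (A (t + a)) i j) ≈⟨ det-scale m (b * b) (mulL L₃ (A (t + a))) ⟩
      pow R (b * b) m * det′ m (mulL L₃ (A (t + a)))      ∎

  d : Carrier → ℕ → Carrier
  d t 0                   = 1#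
  d t 1                   = a + t
  d t 2                   = (a + t) * b
  d t (suc (suc (suc m))) = - (b * b * b) * (pow R (b * b) m * d (t + a) m)

  leading-minors : ∀ N t L → LowerUni L → det′ N (mulL L (A t)) ≈ d t N
  leading-minors 0 t L _ = refl
  leading-minors 1 t L L-uni = trans (det₁-mulL L (A t) L-uni)
    (trans (det₁ (A t)) (+-cong f-1 (trans (*-cong (*-congˡ f-0) f-0) (trans (*-identityʳ _) (*-identityʳ _)))))
  leading-minors 2 t L L-uni = trans (det₂-mulL L (A t) L-uni) (trans (det₂ (A t)) (trans coefficients expand))
    where
    open Solver
    coefficients = +-cong (*-cong (+-cong f-1 (*-cong (*-congˡ f-0) f-0)) (+-cong f-3 (*-cong (*-congˡ f-1) f-1)))
                          (-‿cong (*-cong (+-cong f-2 (*-cong (*-congˡ f-0) f-1)) (+-cong f-2 (*-cong (*-congˡ f-1) f-0))))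
    expand = solve 3 (λ a b t →
      ((a :+ t :* con (ℤ.+ 1) :* con (ℤ.+ 1)) :* (a :* (a :* a) :+ b :+ t :* a :* a)
       :- (a :* a :+ t :* con (ℤ.+ 1) :* a) :* (a :* a :+ t :* a :* con (ℤ.+ 1))) := ((a :+ t) :* b)) refl a b t
  leading-minors (suc (suc (suc m))) t L L-uni =
    trans (reduction m t L L-uni) (*-congˡ (*-congˡ (leading-minors m (t + a) (nextFactor L) (LowerUni-shift 3 _ (blockFactor-uni L L-uni)))))

  d-cong : ∀ {t t′} → t ≈ t′ → ∀ N → d t N ≈ d t′ N
  d-cong t≈t′ 0                   = refl
  d-cong t≈t′ 1                   = +-congˡ t≈t′
  d-cong t≈t′ 2                   = *-congʳ (+-congˡ t≈t′)
  d-cong t≈t′ (suc (suc (suc m))) = *-congˡ (*-congˡ (d-cong (+-congʳ t≈t′) m))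

  hankel≈d : ∀ N → hankel1 R f N ≈ d 0# N
  hankel≈d N = trans (det′-cong′ N (λ i j → sym (trans (mulL-identity (A 0#) i j) (atZero i j))))
                     (leading-minors N 0# identity identity-lowerUni)
    where
    atZero : ∀ i j → A 0# i j ≈ f (i N.+ j N.+ 1)
    atZero i j = trans (+-congˡ (trans (*-assoc _ _ _) (zeroˡ _))) (+-identityʳ _)

  pow-step : ∀ k e → pow R b (3 N.+ (k N.+ k) N.+ e) ≈ (b * b * b) * (pow R (b * b) k * pow R b e)
  pow-step k e = begin
    pow R b (3 N.+ (k N.+ k) N.+ e)               ≈⟨ trans (pow-+ b (3 N.+ (k N.+ k)) e) (*-congʳ (pow-+ b 3 (k N.+ k))) ⟩
    pow R b 3 * pow R b (k N.+ k) * pow R b e      ≈⟨ *-congʳ (*-congˡ (trans (pow-+ b k k) (sym (pow-* b b k)))) ⟩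
    pow R b 3 * pow R (b * b) k * pow R b e        ≈⟨ solve 3 (λ b p q → ((b :* (b :* (b :* con (ℤ.+ 1)))) :* p :* q) := ((b :* b :* b) :* (p :* q))) refl
                                                            b (pow R (b * b) k) (pow R b e) ⟩
    (b * b * b) * (pow R (b * b) k * pow R b e)    ∎
    where open Solver

  -- Solving the recursion: n rounds of it shift t by n·a.
  d-closed : ∀ n r t → d t (3 N.* n N.+ r) ≈ pow R (- 1#) n * (pow R b (3 N.* n N.* n N.+ 2 N.* n N.* r) * d (t + natR R n * a) r)
  d-closed zero    r t = sym (trans (*-identityˡ _) (trans (*-identityˡ _) (d-cong (trans (+-congˡ (zeroˡ a)) (+-identityʳ t)) r)))
  d-closed (suc n) r t = begin
    d t (3 N.* suc n N.+ r)                                          ≡⟨ P.cong (d t) (one-round n r) ⟩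
    - (b * b * b) * (pow R (b * b) k * d (t + a) k)                  ≈⟨ *-congˡ (*-congˡ (d-closed n r (t + a))) ⟩
    - (b * b * b) * (pow R (b * b) k * (pow R (- 1#) n * (pow R b e * d (t + a + natR R n * a) r)))
      ≈⟨ regroup (b * b * b) (pow R (b * b) k) (pow R (- 1#) n) (pow R b e) _ _ (d-cong shiftAgain r) ⟩
    (- 1# * pow R (- 1#) n) * (((b * b * b) * (pow R (b * b) k * pow R b e)) * d (t + natR R (suc n) * a) r)
      ≈⟨ *-congˡ (*-congʳ (sym (pow-step k e))) ⟩
    pow R (- 1#) (suc n) * (pow R b (3 N.+ (k N.+ k) N.+ e) * d (t + natR R (suc n) * a) r)
      ≡⟨ P.cong (λ u → pow R (- 1#) (suc n) * (pow R b u * d (t + natR R (suc n) * a) r)) (P.sym (exponent n r)) ⟩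
    pow R (- 1#) (suc n) * (pow R b (3 N.* suc n N.* suc n N.+ 2 N.* suc n N.* r) * d (t + natR R (suc n) * a) r) ∎
    where
    open Solver
    k = 3 N.* n N.+ r
    e = 3 N.* n N.* n N.+ 2 N.* n N.* r
    one-round : ∀ n r → 3 N.* suc n N.+ r ≡ 3 N.+ (3 N.* n N.+ r)
    one-round = solve-∀
    exponent : ∀ n r → 3 N.* suc n N.* suc n N.+ 2 N.* suc n N.* r ≡ 3 N.+ ((3 N.* n N.+ r) N.+ (3 N.* n N.+ r)) N.+ (3 N.* n N.* n N.+ 2 N.* n N.* r)
    exponent = solve-∀
    shiftAgain : t + a + natR R n * a ≈ t + natR R (suc n) * a
    shiftAgain = solve 3 (λ t a x → (t :+ a :+ x :* a) := (t :+ (con (ℤ.+ 1) :+ x) :* a)) refl t a (natR R n)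
    regroup : ∀ B P s X D D′ → D ≈ D′ → - B * (P * (s * (X * D))) ≈ (- 1# * s) * ((B * (P * X)) * D′)
    regroup B P s X D D′ D≈D′ = trans (*-congˡ (*-congˡ (*-congˡ (*-congˡ D≈D′))))
      (solve 5 (λ B P s X D → (:- B :* (P :* (s :* (X :* D)))) := ((con ℤ.-[1+ 0 ] :* s) :* ((B :* (P :* X)) :* D))) refl B P s X D′)

  d-3n : ∀ n → d 0# (3 N.* n) ≈ pow R (- 1#) n * pow R b (3 N.* n N.* n)
  d-3n n = begin
    d 0# (3 N.* n)                                                    ≡⟨ P.cong (d 0#) (NP.+-identityʳ (3 N.* n)) ⟨
    d 0# (3 N.* n N.+ 0)                                              ≈⟨ d-closed n 0 0# ⟩
    pow R (- 1#) n * (pow R b (3 N.* n N.* n N.+ 2 N.* n N.* 0) * 1#) ≈⟨ *-congˡ (*-identityʳ _) ⟩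
    pow R (- 1#) n * pow R b (3 N.* n N.* n N.+ 2 N.* n N.* 0)        ≡⟨ P.cong (λ u → pow R (- 1#) n * pow R b u) (exponent n) ⟩
    pow R (- 1#) n * pow R b (3 N.* n N.* n)                          ∎
    where
    exponent : ∀ n → 3 N.* n N.* n N.+ 2 N.* n N.* 0 ≡ 3 N.* n N.* n
    exponent = solve-∀

  shifted-a : ∀ n → a + (0# + natR R n * a) ≈ natR R (suc n) * a
  shifted-a n = solve 2 (λ a x → (a :+ (con (ℤ.+ 0) :+ x :* a)) := ((con (ℤ.+ 1) :+ x) :* a)) refl a (natR R n)
    where open Solver

  d-3n+1 : ∀ n → d 0# (3 N.* n N.+ 1) ≈ pow R (- 1#) n * ((natR R (suc n) * a) * pow R b (3 N.* n N.* n N.+ 2 N.* n))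
  d-3n+1 n = trans (d-closed n 1 0#) (*-congˡ (trans (*-comm _ _) (*-cong (shifted-a n) (reflexive (P.cong (pow R b) (exponent n))))))
    where
    exponent : ∀ n → 3 N.* n N.* n N.+ 2 N.* n N.* 1 ≡ 3 N.* n N.* n N.+ 2 N.* n
    exponent = solve-∀

  d-3n+2 : ∀ n → d 0# (3 N.* n N.+ 2) ≈ pow R (- 1#) n * ((natR R (suc n) * a) * pow R b (3 N.* n N.* n N.+ 4 N.* n N.+ 1))
  d-3n+2 n = trans (d-closed n 2 0#) (*-congˡ (begin
    pow R b (3 N.* n N.* n N.+ 2 N.* n N.* 2) * ((a + (0# + natR R n * a)) * b) ≈⟨ *-congˡ (*-congʳ (shifted-a n)) ⟩
    pow R b (3 N.* n N.* n N.+ 2 N.* n N.* 2) * ((natR R (suc n) * a) * b)     ≈⟨ solve 3 (λ p x b → (p :* (x :* b)) := (x :* (b :* p))) refl _ _ b ⟩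
    (natR R (suc n) * a) * pow R b (suc (3 N.* n N.* n N.+ 2 N.* n N.* 2))      ≡⟨ P.cong (λ u → (natR R (suc n) * a) * pow R b u) (P.sym (exponent n)) ⟩
    (natR R (suc n) * a) * pow R b (3 N.* n N.* n N.+ 4 N.* n N.+ 1)            ∎))
    where
    open Solver
    exponent : ∀ n → 3 N.* n N.* n N.+ 4 N.* n N.+ 1 ≡ suc (3 N.* n N.* n N.+ 2 N.* n N.* 2)
    exponent = solve-∀

theorem6p2 : ∀ {c ℓ} (R : CommutativeRing c ℓ) →
    let open CommutativeRing R in
    (a b : Carrier) (f : Series R) → IsF3 R a b f →
      (∀ n → hankel1 R f (3 N.* n) ≈ pow R (- 1#) n * pow R b (3 N.* n N.* n))
      × (∀ n → hankel1 R f (3 N.* n N.+ 1)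
               ≈ pow R (- 1#) n * ((natR R (n N.+ 1) * a) * pow R b (3 N.* n N.* n N.+ 2 N.* n)))
      × (∀ n → 1 N.≤ n → hankel1 R f (3 N.* n N.∸ 1)
               ≈ pow R (- 1#) (n N.∸ 1) * ((natR R n * a) * pow R b (3 N.* n N.* n N.∸ 2 N.* n)))
theorem6p2 R a b f isF = size-3n , size-3n+1 , size-3n-1
  where
  open CommutativeRing R
  open HankelRecursion R a b f isF

  size-3n : ∀ n → hankel1 R f (3 N.* n) ≈ pow R (- 1#) n * pow R b (3 N.* n N.* n)
  size-3n n = trans (hankel≈d (3 N.* n)) (d-3n n)

  size-3n+1 : ∀ n → hankel1 R f (3 N.* n N.+ 1) ≈ pow R (- 1#) n * ((natR R (n N.+ 1) * a) * pow R b (3 N.* n N.* n N.+ 2 N.* n))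
  size-3n+1 n = trans (hankel≈d (3 N.* n N.+ 1))
    (trans (d-3n+1 n) (reflexive (P.cong (λ m → pow R (- 1#) n * ((natR R m * a) * pow R b (3 N.* n N.* n N.+ 2 N.* n))) (NP.+-comm 1 n))))

  -- 3(m+1) - 1 = 3m + 2 and 3(m+1)² - 2(m+1) = 3m² + 4m + 1
  size-3n-1 : ∀ n → 1 N.≤ n → hankel1 R f (3 N.* n N.∸ 1) ≈ pow R (- 1#) (n N.∸ 1) * ((natR R n * a) * pow R b (3 N.* n N.* n N.∸ 2 N.* n))
  size-3n-1 (N.suc m) _ = P.subst₂ (λ size e → hankel1 R f size ≈ pow R (- 1#) m * ((natR R (N.suc m) * a) * pow R b e))
    (P.sym (size≡ m)) (P.sym (exponent≡ m)) (trans (hankel≈d (3 N.* m N.+ 2)) (d-3n+2 m))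
    where
    size≡ : ∀ m → 3 N.* N.suc m N.∸ 1 ≡ 3 N.* m N.+ 2
    size≡ m = P.cong (N._∸ 1) (lemma m)
      where
      lemma : ∀ m → 3 N.* N.suc m ≡ 1 N.+ (3 N.* m N.+ 2)
      lemma = solve-∀
    exponent≡ : ∀ m → 3 N.* N.suc m N.* N.suc m N.∸ 2 N.* N.suc m ≡ 3 N.* m N.* m N.+ 4 N.* m N.+ 1
    exponent≡ m = P.trans (P.cong (N._∸ 2 N.* N.suc m) (lemma m)) (NP.m+n∸n≡m _ (2 N.* N.suc m))
      where
      lemma : ∀ m → 3 N.* N.suc m N.* N.suc m ≡ (3 N.* m N.* m N.+ 4 N.* m N.+ 1) N.+ 2 N.* N.suc m
      lemma = solve-∀
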